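{- Let $G=(V,E)$ be an arbitrary $n$-node network graph in which each node has a unique $b=O(\log n)$-bit identifier, and let $S\subseteq V$ be a set of living vertices. There is a deterministic distributed algorithm that, in $O(\log^6 n)$ rounds of the $\mathsf{LOCAL}$ model, finds a subset $S'\subseteq S$ with $|S'|\ge |S|/2$ such that the subgraph $G[S']$ induced by $S'$ is partitioned into pairwise disjoint, non-adjacent clusters, each of weak-diameter $O(\log^3 n)$ in $G$. Moreover, for each such cluster $\mathcal{C}$ there is a Steiner tree $T_{\mathcal{C}}$ in $G$ of radius $O(\log^3 n)$ whose terminal nodes are exactly the nodes of $\mathcal{C}$, and each edge of $G$ is in $O(\log n)$ of these Steiner trees.
   Context: The $\mathsf{LOCAL}$ model: the network is the graph $G$ with one processor per node; computation proceeds in synchronous rounds, and per round each node may send one message of unbounded size to each neighbor; initially nodes know only their neighbors (and whether they are in $S$). A vertex set $H$ has weak-diameter at most $d$ in $G$ if $G$ contains a path of length at most $d$ between any two vertices of $H$. Clusters are non-adjacent if no edge of $G$ joins two different clusters. A Steiner tree is a tree (a subgraph of $G$) whose nodes are labelled terminal or nonterminal. -}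

module Defs where

open import Data.Nat using (ℕ; zero; suc; _+_; _*_; _^_; _≤_; _<_)
open import Data.Nat.Logarithm using (⌈log₂_⌉)
open import Data.Bool using (Bool; true; false)
open import Data.Fin using (Fin)
open import Data.Product using (Σ; Σ-syntax; _×_; _,_)
open import Data.List using (List; length)
open import Data.List.Relation.Unary.All using (All)
open import Data.List.Relation.Unary.Unique.Propositional using (Unique)
open import Function using (_⇔_)
open import Relation.Binary.PropositionalEquality using (_≡_)
open import Relation.Nullary using (¬_)

-- Log factor used for all O(·) bounds:  L n = ⌈log₂ n⌉ + 1
-- (the +1 only absorbs the degenerate cases n ≤ 2).

L : ℕ → ℕ
L n = suc ⌈log₂ n ⌉

record Instance (n : ℕ) : Set where
  field
    adj    : Fin n → Fin n → Bool
    adj-sym    : ∀ u v → adj u v ≡ adj v u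
    adj-irrefl : ∀ u → adj u u ≡ false
    ident  : Fin n → ℕ
    ident-inj : ∀ u v → ident u ≡ ident v → u ≡ v
    inS    : Fin n → Bool
open Instance public

IdsBounded : ∀ {n} → ℕ → Instance n → Set
IdsBounded {n} cid I = ∀ u → ident I u < 2 ^ (cid * L n)

data Walk {n} (I : Instance n) : Fin n → Fin n → ℕ → Set where
  here : ∀ {u} → Walk I u u 0
  step : ∀ {u v w k} → adj I u v ≡ true → Walk I v w k → Walk I u w (suc k)

WithinDist : ∀ {n} → Instance n → ℕ → Fin n → Fin n → Set
WithinDist I d u v = Σ[ k ∈ ℕ ] (k ≤ d × Walk I u v k)

-- The initial knowledge of a node u is its identifier,
-- whether it is in S, and the identifiers of its neighbours.
-- After r rounds, a node v knows exactly the initial knowledge of all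
-- nodes within distance r (keyed by identifiers).

NbrId : ∀ {n} → Instance n → Fin n → ℕ → Set
NbrId I u y = Σ[ z ∈ Fin _ ] (adj I u z ≡ true × ident I z ≡ y)

SameInit : ∀ {n} → Instance n → Fin n → Instance n → Fin n → Set
SameInit I u J u' =
  ident I u ≡ ident J u' × inS I u ≡ inS J u' ×
  (∀ y → NbrId I u y ⇔ NbrId J u' y)

BallIncl : ∀ {n} → ℕ → Instance n → Fin n → Instance n → Fin n → Set
BallIncl r I v J w =
  ∀ u → WithinDist I r v u →
    Σ[ u' ∈ Fin _ ] (WithinDist J r w u' × SameInit I u J u')

SameView : ∀ {n} → ℕ → Instance n → Fin n → Instance n → Fin n → Set
SameView r I v J w =
  ident I v ≡ ident J w × BallIncl r I v J w × BallIncl r J w I v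

record Output : Set where
  constructor out
  field
    inS′    : Bool
    cluster : ℕ
open Output public

-- A deterministic LOCAL algorithm for n-node networks (n is known)
-- running in `rounds` rounds: every node's output is a function of its
-- rounds-hop view.
record Algorithm (n : ℕ) : Set where
  field
    rounds : ℕ
    run    : Instance n → Fin n → Output
    local  : ∀ (I J : Instance n) v w → SameView rounds I v J w →
             run I v ≡ run J w
open Algorithm public

count : ∀ {n} → (Fin n → Bool) → ℕ
count {zero}  f = 0
count {suc n} f with f Fin.zero
... | true  = suc (count (λ i → f (Fin.suc i)))
... | false = count (λ i → f (Fin.suc i))

-- Rooted Steiner trees in G (as subgraphs given by parent pointers and
-- depths; radius ≤ R is witnessed by all depths ≤ R from the root).

record SteinerTree {n} (I : Instance n) (R : ℕ) : Set where
  field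
    inT    : Fin n → Bool
    root   : Fin n
    parent : Fin n → Fin n
    depth  : Fin n → ℕ
    root-in   : inT root ≡ true
    root-dep  : depth root ≡ 0
    par-in    : ∀ u → inT u ≡ true → ¬ (u ≡ root) → inT (parent u) ≡ true
    par-adj   : ∀ u → inT u ≡ true → ¬ (u ≡ root) → adj I u (parent u) ≡ true
    par-dep   : ∀ u → inT u ≡ true → ¬ (u ≡ root) →
                suc (depth (parent u)) ≡ depth u
    dep-bound : ∀ u → inT u ≡ true → depth u ≤ R
open SteinerTree public

EdgeIn : ∀ {n} {I : Instance n} {R} → SteinerTree I R → Fin n → Fin n → Set
EdgeIn T x y =
  (inT T x ≡ true × ¬ (x ≡ root T) × parent T x ≡ y) Data.Sum.⊎
  (inT T y ≡ true × ¬ (y ≡ root T) × parent T y ≡ x)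
  where import Data.Sum

module _ {n} (I : Instance n) (o : Fin n → Output) where

  InS′ : Fin n → Set
  InS′ u = inS′ (o u) ≡ true

  InCluster : ℕ → Fin n → Set
  InCluster c u = InS′ u × cluster (o u) ≡ c

  UsedLabel : ℕ → Set
  UsedLabel c = Σ[ u ∈ Fin n ] InCluster c u

  record Valid (C : ℕ) : Set where
    field
      subset     : ∀ u → InS′ u → inS I u ≡ true
      large      : count (inS I) ≤ 2 * count (λ u → inS′ (o u))
      nonadj     : ∀ u v → InS′ u → InS′ v → adj I u v ≡ true →
                   cluster (o u) ≡ cluster (o v)
      weakDiam   : ∀ u v → InS′ u → InS′ v → cluster (o u) ≡ cluster (o v) →
                   WithinDist I (C * L n ^ 3) u v
      trees      : (c : ℕ) → UsedLabel c → SteinerTree I (C * L n ^ 3)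
      terminals  : ∀ c (h : UsedLabel c) u → InCluster c u →
                   inT (trees c h) u ≡ true
      congestion : ∀ x y → adj I x y ≡ true →
                   (cs : List (Σ ℕ UsedLabel)) →
                   Unique (Data.List.map Data.Product.proj₁ cs) →
                   All (λ { (c , h) → EdgeIn (trees c h) x y }) cs →
                   length cs ≤ C * L n

-- Clusters are named by the identifier of their centre; initially every node of S is its own
-- cluster. There is one phase per identifier bit k, from the most significant one. In phase k a
-- cluster is red or blue according to bit k of its label, and adjacent living nodes already
-- agree on all bits above k. For T steps, every living blue node adjacent to a non-stopped red
-- cluster proposes to join it; the red cluster accepts if it has at most K times as many members
-- as proposals, and otherwise it stops growing and its proposers die. An accepting cluster grows
-- by a factor 1 + 1/K, so after T steps no red cluster can still be growing (it would exceed
-- 2^B nodes): no red node is adjacent to a blue one, and adjacent living nodes agree on bit k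
-- too. Every death is charged to K nodes of a cluster that stops, so each phase kills at most a
-- 1/K fraction of the living nodes, and over B ≤ K/2 phases at most half of S. Joining nodes
-- record their parent, which yields Steiner trees of depth at most B·T in which every node lies
-- in at most B + 1 trees; and all counts a node needs lie within distance O(B·T), so a step is
-- simulated in O(B·T) rounds of the LOCAL model.

module Submission where

open import Data.Bool using (Bool; true; false; _∧_; _∨_; not; if_then_else_)
open import Data.Bool.Properties using (∧-zeroʳ; T-≡)
open import Data.Empty using (⊥; ⊥-elim)
open import Data.Fin using (Fin)
open import Data.List using (List; []; _∷_; length; map; _++_)
open import Data.List.Membership.Propositional using (_∈_)
open import Data.List.Membership.Propositional.Properties using (∈-++⁺ˡ; ∈-++⁺ʳ)
open import Data.List.Properties using (length-map; length-++)
open import Data.List.Relation.Unary.All using (All; []; _∷_)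
import Data.List.Relation.Unary.All as All
import Data.List.Relation.Unary.All.Properties as All
open import Data.List.Relation.Unary.AllPairs using ([]; _∷_)
open import Data.List.Relation.Unary.Any using (here; there)
open import Data.List.Relation.Unary.Unique.Propositional using (Unique)
open import Data.Maybe using (Maybe; just; nothing; is-just; fromMaybe)
open import Data.Maybe.Properties using (just-injective)
open import Data.Nat using (ℕ; zero; suc; _+_; _*_; _^_; _≤_; _<_; z≤n; s≤s; _≡ᵇ_; _≤ᵇ_; _<ᵇ_; ⌊_/2⌋; >-nonZero)
open import Data.Nat.Properties
open import Data.Nat.Tactic.RingSolver
open import Data.Product using (Σ; Σ-syntax; _×_; _,_; proj₁; proj₂)
open import Data.Sum using (_⊎_; inj₁; inj₂)
open import Function using (Equivalence)
open import Relation.Binary.PropositionalEquality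
open import Relation.Nullary using (¬_; yes; no)

open import Defs

≡ᵇ-sound : ∀ a b → (a ≡ᵇ b) ≡ true → a ≡ b
≡ᵇ-sound a b e = ≡ᵇ⇒≡ a b (Equivalence.from T-≡ e)

≡ᵇ-refl : ∀ a → (a ≡ᵇ a) ≡ true
≡ᵇ-refl a = Equivalence.to T-≡ (≡⇒≡ᵇ a a refl)

≡ᵇ-false : ∀ a b → ¬ (a ≡ b) → (a ≡ᵇ b) ≡ false
≡ᵇ-false a b ne with a ≡ᵇ b in e
... | true = ⊥-elim (ne (≡ᵇ-sound a b e))
... | false = refl

≡ᵇ-sym : ∀ a b → (a ≡ᵇ b) ≡ (b ≡ᵇ a)
≡ᵇ-sym zero zero = refl
≡ᵇ-sym zero (suc b) = refl
≡ᵇ-sym (suc a) zero = refl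
≡ᵇ-sym (suc a) (suc b) = ≡ᵇ-sym a b

∧-true⁻ˡ : ∀ {a b} → (a ∧ b) ≡ true → a ≡ true
∧-true⁻ˡ {true} e = refl

∧-true⁻ʳ : ∀ {a b} → (a ∧ b) ≡ true → b ≡ true
∧-true⁻ʳ {true} e = e

∧-true⁺ : ∀ {a b} → a ≡ true → b ≡ true → (a ∧ b) ≡ true
∧-true⁺ refl refl = refl

∨-true⁻ : ∀ {a b} → (a ∨ b) ≡ true → a ≡ true ⊎ b ≡ true
∨-true⁻ {true} e = inj₁ refl
∨-true⁻ {false} e = inj₂ e

∨-true⁺ˡ : ∀ {a} b → a ≡ true → (a ∨ b) ≡ true
∨-true⁺ˡ b refl = refl

∨-true⁺ʳ : ∀ a {b} → b ≡ true → (a ∨ b) ≡ true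
∨-true⁺ʳ true e = refl
∨-true⁺ʳ false e = e

∨-false⁻ˡ : ∀ {a b} → (a ∨ b) ≡ false → a ≡ false
∨-false⁻ˡ {false} e = refl

∨-false⁻ʳ : ∀ {a b} → (a ∨ b) ≡ false → b ≡ false
∨-false⁻ʳ {false} e = e

not-false⁻ : ∀ {a} → not a ≡ false → a ≡ true
not-false⁻ {true} e = refl

true≢false : ∀ {a} → a ≡ true → a ≡ false → ⊥
true≢false refl ()

not-true⁻ : ∀ {a} → not a ≡ true → a ≡ false
not-true⁻ {false} e = refl

not-true⁺ : ∀ {a} → a ≡ false → not a ≡ true
not-true⁺ refl = refl

just≢nothing : ∀ {A : Set} {a : Maybe A} {x} → a ≡ just x → a ≡ nothing → ⊥
just≢nothing refl ()

fromBool : Bool → ℕ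
fromBool true = 1
fromBool false = 0

fromBool≤1 : ∀ b → fromBool b ≤ 1
fromBool≤1 true = s≤s z≤n
fromBool≤1 false = z≤n

bool-ext : ∀ {a b} → (a ≡ true → b ≡ true) → (b ≡ true → a ≡ true) → a ≡ b
bool-ext {true} {true} f g = refl
bool-ext {true} {false} f g = sym (f refl)
bool-ext {false} {true} f g = g refl
bool-ext {false} {false} f g = refl

sumBelow : ℕ → (ℕ → ℕ) → ℕ
sumBelow zero f = 0
sumBelow (suc m) f = sumBelow m f + f m

countBelow : ℕ → (ℕ → Bool) → ℕ
countBelow m P = sumBelow m (λ y → fromBool (P y))

sumBelow-cong : ∀ m {f g} → (∀ y → y < m → f y ≡ g y) → sumBelow m f ≡ sumBelow m g
sumBelow-cong zero h = refl
sumBelow-cong (suc m) h = cong₂ _+_ (sumBelow-cong m (λ y y<m → h y (m<n⇒m<1+n y<m))) (h m ≤-refl)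

sumBelow-mono : ∀ m {f g} → (∀ y → y < m → f y ≤ g y) → sumBelow m f ≤ sumBelow m g
sumBelow-mono zero h = z≤n
sumBelow-mono (suc m) h = +-mono-≤ (sumBelow-mono m (λ y y<m → h y (m<n⇒m<1+n y<m))) (h m ≤-refl)

+-interchange : ∀ a b c d → a + b + (c + d) ≡ a + c + (b + d)
+-interchange = solve-∀

sumBelow-+ : ∀ m f g → sumBelow m (λ y → f y + g y) ≡ sumBelow m f + sumBelow m g
sumBelow-+ zero f g = refl
sumBelow-+ (suc m) f g rewrite sumBelow-+ m f g = +-interchange (sumBelow m f) (sumBelow m g) (f m) (g m)

sumBelow-zero : ∀ m f → (∀ y → y < m → f y ≡ 0) → sumBelow m f ≡ 0
sumBelow-zero m f h = trans (sumBelow-cong m h) (zeros m)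
  where
  zeros : ∀ m → sumBelow m (λ _ → 0) ≡ 0
  zeros zero = refl
  zeros (suc m) = trans (+-identityʳ _) (zeros m)

sumBelow-swap : ∀ m k (h : ℕ → ℕ → ℕ) →
  sumBelow m (λ y → sumBelow k (λ t → h y t)) ≡ sumBelow k (λ t → sumBelow m (λ y → h y t))
sumBelow-swap zero k h = sym (sumBelow-zero k _ (λ _ _ → refl))
sumBelow-swap (suc m) k h rewrite sumBelow-swap m k h =
  sym (sumBelow-+ k (λ t → sumBelow m (λ y → h y t)) (λ t → h m t))

sumBelow-const≤ : ∀ m f c → (∀ y → y < m → f y ≤ c) → sumBelow m f ≤ m * c
sumBelow-const≤ zero f c h = z≤n
sumBelow-const≤ (suc m) f c h =
  subst (sumBelow m f + f m ≤_) (+-comm (m * c) c)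
    (+-mono-≤ (sumBelow-const≤ m f c (λ y y<m → h y (m<n⇒m<1+n y<m))) (h m ≤-refl))

countBelow≤ : ∀ m P → countBelow m P ≤ m
countBelow≤ m P = subst (countBelow m P ≤_) (*-identityʳ m) (sumBelow-const≤ m _ 1 (λ y _ → fromBool≤1 (P y)))

sumBelow-single : ∀ m t a → t < m → sumBelow m (λ y → if (y ≡ᵇ t) then a else 0) ≡ a
sumBelow-single zero t a ()
sumBelow-single (suc m) t a t<sm with m ≟ t
... | yes refl rewrite ≡ᵇ-refl m =
  trans (cong (_+ a) (sumBelow-zero m _ (λ y y<m → cong (λ b → if b then a else 0) (≡ᵇ-false y m (λ e → <-irrefl e y<m))))) refl
... | no m≢t rewrite ≡ᵇ-false m t m≢t =
  trans (+-identityʳ _) (sumBelow-single m t a (≤∧≢⇒< (≤-pred t<sm) (λ e → m≢t (sym e))))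

countBelow-partition : ∀ m k (P : ℕ → Bool) (f : ℕ → ℕ) →
  (∀ y → y < m → P y ≡ true → f y < k) →
  countBelow m P ≡ sumBelow k (λ t → countBelow m (λ y → P y ∧ (f y ≡ᵇ t)))
countBelow-partition m k P f h =
  trans (sumBelow-cong m inner) (sumBelow-swap m k (λ y t → fromBool (P y ∧ (f y ≡ᵇ t))))
  where
  inner : ∀ y → y < m → fromBool (P y) ≡ sumBelow k (λ t → fromBool (P y ∧ (f y ≡ᵇ t)))
  inner y y<m with P y in e
  ... | true = sym (trans (sumBelow-cong k (λ t _ → lem (f y) t)) (sumBelow-single k (f y) 1 (h y y<m e)))
    where
    lem : ∀ a t → fromBool (a ≡ᵇ t) ≡ (if (t ≡ᵇ a) then 1 else 0)
    lem a t rewrite ≡ᵇ-sym a t with t ≡ᵇ a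
    ... | true = refl
    ... | false = refl
  ... | false = sym (sumBelow-zero k _ (λ _ _ → refl))

countBelow-∨ : ∀ m P Q → (∀ y → P y ≡ true → Q y ≡ true → ⊥) →
  countBelow m (λ y → P y ∨ Q y) ≡ countBelow m P + countBelow m Q
countBelow-∨ m P Q d = trans (sumBelow-cong m lem) (sumBelow-+ m (λ y → fromBool (P y)) (λ y → fromBool (Q y)))
  where
  lem : ∀ y → y < m → fromBool (P y ∨ Q y) ≡ fromBool (P y) + fromBool (Q y)
  lem y _ with P y in e1 | Q y in e2
  ... | true | true = ⊥-elim (d y e1 e2)
  ... | true | false = refl
  ... | false | true = refl
  ... | false | false = refl

countBelow-mono : ∀ m P Q → (∀ y → y < m → P y ≡ true → Q y ≡ true) → countBelow m P ≤ countBelow m Q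
countBelow-mono m P Q h = sumBelow-mono m lem
  where
  lem : ∀ y → y < m → fromBool (P y) ≤ fromBool (Q y)
  lem y y<m with P y in e
  ... | true rewrite h y y<m e = ≤-refl
  ... | false = z≤n

countBelow-cong : ∀ m P Q → (∀ y → y < m → P y ≡ Q y) → countBelow m P ≡ countBelow m Q
countBelow-cong m P Q h = sumBelow-cong m (λ y y<m → cong fromBool (h y y<m))

countBelow-pos : ∀ m P y → y < m → P y ≡ true → 1 ≤ countBelow m P
countBelow-pos m P y y<m e = ≤-trans (≤-reflexive (sym (cong fromBool e)))
  (≤-trans (≤-reflexive (sym (sumBelow-single m y (fromBool (P y)) y<m))) (sumBelow-mono m lem))
  where
  lem : ∀ z → z < m → (if (z ≡ᵇ y) then fromBool (P y) else 0) ≤ fromBool (P z)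
  lem z _ with z ≡ᵇ y in e'
  ... | true rewrite ≡ᵇ-sound z y e' = ≤-refl
  ... | false = z≤n

firstBelow : ℕ → (ℕ → Bool) → Maybe ℕ
firstBelow zero P = nothing
firstBelow (suc m) P with firstBelow m P
... | just y = just y
... | nothing = if P m then just m else nothing

firstBelow-sound : ∀ m P y → firstBelow m P ≡ just y → y < m × P y ≡ true
firstBelow-sound zero P y ()
firstBelow-sound (suc m) P y e with firstBelow m P in e'
... | just z with e
... | refl = let (a , b) = firstBelow-sound m P z e' in m<n⇒m<1+n a , b
firstBelow-sound (suc m) P y e | nothing with P m in e''
firstBelow-sound (suc m) P y refl | nothing | true = ≤-refl , e''
firstBelow-sound (suc m) P y () | nothing | false

firstBelow-complete : ∀ m P y → y < m → P y ≡ true → Σ[ z ∈ ℕ ] firstBelow m P ≡ just z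
firstBelow-complete zero P y () e
firstBelow-complete (suc m) P y y<m e with firstBelow m P in e'
... | just z = z , refl
... | nothing with P m in e''
... | true = m , refl
... | false with m ≟ y
... | yes refl = ⊥-elim (true≢false e e'')
... | no m≢y = let (z , q) = firstBelow-complete m P y (≤∧≢⇒< (≤-pred y<m) (λ eq → m≢y (sym eq))) e in
   ⊥-elim (just≢nothing q e')

firstBelow-cong : ∀ m P Q → (∀ y → y < m → P y ≡ Q y) → firstBelow m P ≡ firstBelow m Q
firstBelow-cong zero P Q h = refl
firstBelow-cong (suc m) P Q h with firstBelow m P | firstBelow m Q | firstBelow-cong m P Q (λ y y<m → h y (m<n⇒m<1+n y<m))
... | just y | .(just y) | refl = refl
... | nothing | .nothing | refl rewrite h m ≤-refl = refl

anyBelow : ℕ → (ℕ → Bool) → Bool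
anyBelow m P = is-just (firstBelow m P)

anyBelow-sound : ∀ m P → anyBelow m P ≡ true → Σ[ z ∈ ℕ ] (z < m × P z ≡ true)
anyBelow-sound m P e with firstBelow m P in e'
... | just z = z , firstBelow-sound m P z e'
anyBelow-sound m P () | nothing

anyBelow-complete : ∀ m P z → z < m → P z ≡ true → anyBelow m P ≡ true
anyBelow-complete m P z lt pz with firstBelow-complete m P z lt pz
... | w , e rewrite e = refl

anyBelow-cong : ∀ m P Q → (∀ y → y < m → P y ≡ Q y) → anyBelow m P ≡ anyBelow m Q
anyBelow-cong m P Q h = cong is-just (firstBelow-cong m P Q h)

sumFin : ∀ n → (Fin n → ℕ) → ℕ
sumFin zero g = 0
sumFin (suc n) g = g Fin.zero + sumFin n (λ i → g (Fin.suc i))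

count≡sumFin : ∀ {n} (f : Fin n → Bool) → count f ≡ sumFin n (λ u → fromBool (f u))
count≡sumFin {zero} f = refl
count≡sumFin {suc n} f with f Fin.zero
... | true = cong suc (count≡sumFin (λ i → f (Fin.suc i)))
... | false = count≡sumFin (λ i → f (Fin.suc i))

sumFin-cong : ∀ n {f g : Fin n → ℕ} → (∀ u → f u ≡ g u) → sumFin n f ≡ sumFin n g
sumFin-cong zero h = refl
sumFin-cong (suc n) h = cong₂ _+_ (h Fin.zero) (sumFin-cong n (λ i → h (Fin.suc i)))

sumFin-zero : ∀ n (f : Fin n → ℕ) → (∀ u → f u ≡ 0) → sumFin n f ≡ 0
sumFin-zero zero f h = refl
sumFin-zero (suc n) f h rewrite h Fin.zero = sumFin-zero n _ (λ i → h (Fin.suc i))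

sumFin-+ : ∀ n (f g : Fin n → ℕ) → sumFin n (λ u → f u + g u) ≡ sumFin n f + sumFin n g
sumFin-+ zero f g = refl
sumFin-+ (suc n) f g rewrite sumFin-+ n (λ i → f (Fin.suc i)) (λ i → g (Fin.suc i)) =
  +-interchange (f Fin.zero) (g Fin.zero) (sumFin n (λ i → f (Fin.suc i))) (sumFin n (λ i → g (Fin.suc i)))

sumFin-sumBelow : ∀ n m (h : Fin n → ℕ → ℕ) →
  sumFin n (λ u → sumBelow m (λ y → h u y)) ≡ sumBelow m (λ y → sumFin n (λ u → h u y))
sumFin-sumBelow zero m h = sym (sumBelow-zero m _ (λ _ _ → refl))
sumFin-sumBelow (suc n) m h rewrite sumFin-sumBelow n m (λ i → h (Fin.suc i)) =
  sym (sumBelow-+ m (λ y → h Fin.zero y) (λ y → sumFin n (λ i → h (Fin.suc i) y)))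

sumFin-single : ∀ n (g : Fin n → Bool) (u0 : Fin n) → g u0 ≡ true →
  (∀ u → g u ≡ true → u ≡ u0) → sumFin n (λ u → fromBool (g u)) ≡ 1
sumFin-single (suc n) g Fin.zero e h with g Fin.zero
... | true = cong suc (sumFin-zero n _ lem)
  where
  lem : ∀ i → fromBool (g (Fin.suc i)) ≡ 0
  lem i with g (Fin.suc i) in e'
  ... | true with h (Fin.suc i) e'
  ... | ()
  lem i | false = refl
sumFin-single (suc n) g (Fin.suc u0) e h with g Fin.zero in e0
... | true with h Fin.zero e0
... | ()
sumFin-single (suc n) g (Fin.suc u0) e h | false =
  sumFin-single n (λ i → g (Fin.suc i)) u0 e (λ u eu → Data.Fin.Properties.suc-injective (h (Fin.suc u) eu))
  where import Data.Fin.Properties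

module _ {n} (id : Fin n → ℕ) (inj : ∀ u v → id u ≡ id v → u ≡ v) (m : ℕ)
         (bnd : ∀ u → id u < m) where

  sumFin≡countBelow : (P : ℕ → Bool) → (∀ y → P y ≡ true → Σ[ u ∈ Fin n ] id u ≡ y) →
    sumFin n (λ u → fromBool (P (id u))) ≡ countBelow m P
  sumFin≡countBelow P hP =
    trans (sumFin-cong n by-value)
    (trans (sumFin-sumBelow n m (λ u y → fromBool (P y ∧ (id u ≡ᵇ y))))
      (sumBelow-cong m unique-preimage))
    where
    by-value : ∀ u → fromBool (P (id u)) ≡ sumBelow m (λ y → fromBool (P y ∧ (id u ≡ᵇ y)))
    by-value u = sym (trans (sumBelow-cong m l) (sumBelow-single m (id u) (fromBool (P (id u))) (bnd u)))
      where
      l : ∀ y → y < m → fromBool (P y ∧ (id u ≡ᵇ y)) ≡ (if (y ≡ᵇ id u) then fromBool (P (id u)) else 0)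
      l y _ with y ≡ᵇ id u in e
      ... | true rewrite ≡ᵇ-sound y (id u) e | ≡ᵇ-refl (id u) with P (id u)
      ... | true = refl
      ... | false = refl
      l y _ | false rewrite ≡ᵇ-sym (id u) y | e with P y
      ... | true = refl
      ... | false = refl
    unique-preimage : ∀ y → y < m → sumFin n (λ u → fromBool (P y ∧ (id u ≡ᵇ y))) ≡ fromBool (P y)
    unique-preimage y _ with P y in e
    ... | false = sumFin-zero n _ (λ _ → refl)
    ... | true with hP y e
    ... | (u0 , eu0) = sumFin-single n (λ u → (id u ≡ᵇ y)) u0
          (subst (λ z → (z ≡ᵇ y) ≡ true) (sym eu0) (≡ᵇ-refl y))
          (λ u eu → inj u u0 (trans (≡ᵇ-sound _ _ eu) (sym eu0)))

remove-∈ : ∀ {A : Set} {x : A} (ys : List A) → x ∈ ys →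
  Σ[ zs ∈ List A ] (length ys ≡ suc (length zs) × (∀ z → z ∈ ys → ¬ (z ≡ x) → z ∈ zs))
remove-∈ (y ∷ ys) (here refl) = ys , refl , λ { z (here refl) ne → ⊥-elim (ne refl) ; z (there p) ne → p }
remove-∈ (y ∷ ys) (there p) with remove-∈ ys p
... | zs , e , f = y ∷ zs , cong suc e , λ { z (here refl) ne → here refl ; z (there q) ne → there (f z q ne) }

Unique-length≤ : ∀ {A : Set} (xs ys : List A) → Unique xs → All (λ x → x ∈ ys) xs → length xs ≤ length ys
Unique-length≤ [] ys u a = z≤n
Unique-length≤ (x ∷ xs) ys (nx ∷ u) (px ∷ a) with remove-∈ ys px
... | zs , e , f = subst (suc (length xs) ≤_) (sym e)
  (s≤s (Unique-length≤ xs zs u (mapAll nx a)))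
  where
  mapAll : ∀ {ws} → All (λ w → ¬ (x ≡ w)) ws → All (λ w → w ∈ ys) ws → All (λ w → w ∈ zs) ws
  mapAll [] [] = []
  mapAll (n1 ∷ ns) (q ∷ qs) = f _ q (λ eq → n1 (sym eq)) ∷ mapAll ns qs

countBelow-witness : ∀ m P → 1 ≤ countBelow m P → Σ[ y ∈ ℕ ] (y < m × P y ≡ true)
countBelow-witness zero P ()
countBelow-witness (suc m) P h with P m in e
... | true = m , ≤-refl , e
... | false with countBelow-witness m P (subst (1 ≤_) (+-identityʳ _) h)
... | y , lt , py = y , m<n⇒m<1+n lt , py

sumBelow-* : ∀ m c f → c * sumBelow m f ≡ sumBelow m (λ t → c * f t)
sumBelow-* zero c f = *-zeroʳ c
sumBelow-* (suc m) c f = trans (*-distribˡ-+ c (sumBelow m f) (f m)) (cong (_+ c * f m) (sumBelow-* m c f))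

≤ᵇ-sound : ∀ a b → (a ≤ᵇ b) ≡ true → a ≤ b
≤ᵇ-sound a b e = ≤ᵇ⇒≤ a b (Equivalence.from T-≡ e)

≤ᵇ-false : ∀ a b → (a ≤ᵇ b) ≡ false → b < a
≤ᵇ-false a b e = ≰⇒> (λ a≤b → true≢false (Equivalence.to T-≡ (≤⇒≤ᵇ a≤b)) e)

odd : ℕ → Bool
odd zero = false
odd (suc zero) = true
odd (suc (suc n)) = odd n

n≡odd+2⌊n/2⌋ : ∀ n → n ≡ fromBool (odd n) + 2 * ⌊ n /2⌋
n≡odd+2⌊n/2⌋ zero = refl
n≡odd+2⌊n/2⌋ (suc zero) = refl
n≡odd+2⌊n/2⌋ (suc (suc n)) = trans (cong (2 +_) (n≡odd+2⌊n/2⌋ n)) (shift (fromBool (odd n)) ⌊ n /2⌋)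
  where
  shift : ∀ b h → 2 + (b + 2 * h) ≡ b + 2 * suc h
  shift = solve-∀

⌊n/2⌋-odd-injective : ∀ a b → ⌊ a /2⌋ ≡ ⌊ b /2⌋ → odd a ≡ odd b → a ≡ b
⌊n/2⌋-odd-injective a b h p = trans (n≡odd+2⌊n/2⌋ a) (trans (cong₂ (λ u v → fromBool u + 2 * v) p h) (sym (n≡odd+2⌊n/2⌋ b)))

dropBits : ℕ → ℕ → ℕ
dropBits zero c = c
dropBits (suc k) c = ⌊ dropBits k c /2⌋

⌊n/2⌋< : ∀ n k → n < 2 * k → ⌊ n /2⌋ < k
⌊n/2⌋< n k lt with n≡odd+2⌊n/2⌋ n
... | e = *-cancelˡ-< 2 (⌊ n /2⌋) k (≤-<-trans (≤-trans (m≤n+m (2 * ⌊ n /2⌋) (fromBool (odd n))) (≤-reflexive (sym e))) lt)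

dropBits-<2^ : ∀ B c → c < 2 ^ B → dropBits B c ≡ 0
dropBits-<2^ B c lt = n<1⇒n≡0 (dropBits-< B 0 c (subst (λ z → c < 2 ^ z) (sym (+-identityʳ B)) lt))
  where
  dropBits-< : ∀ k j c → c < 2 ^ (k + j) → dropBits k c < 2 ^ j
  dropBits-< zero j c lt = lt
  dropBits-< (suc k) j c lt =
    ⌊n/2⌋< (dropBits k c) (2 ^ j) (dropBits-< k (suc j) c (subst (λ z → c < 2 ^ z) (sym (+-suc k j)) lt))

-- The algorithm runs on the graph transported to identifiers: vertex y is the node with
-- identifier y (if any), so states and views are indexed by identifiers, not by Fin n.
record IdGraph : Set where
  constructor idGraph
  field
    adjG : ℕ → ℕ → Bool
    inSG : ℕ → Bool
open IdGraph public

module Balls (M : ℕ) where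

  Ball : IdGraph → ℕ → ℕ → ℕ → Bool
  Ball G zero x y = x ≡ᵇ y
  Ball G (suc k) x y = Ball G k x y ∨ anyBelow M (λ z → Ball G k x z ∧ adjG G z y)

  ball-refl : ∀ G k x → Ball G k x x ≡ true
  ball-refl G zero x = ≡ᵇ-refl x
  ball-refl G (suc k) x = ∨-true⁺ˡ _ (ball-refl G k x)

  ball-0 : ∀ G x y → Ball G 0 x y ≡ true → x ≡ y
  ball-0 G x y e = ≡ᵇ-sound x y e

  ball-s : ∀ G k x y → Ball G k x y ≡ true → Ball G (suc k) x y ≡ true
  ball-s G k x y e = ∨-true⁺ˡ _ e

  ball-step : ∀ G k x z y → Ball G k x z ≡ true → z < M → adjG G z y ≡ true →
              Ball G (suc k) x y ≡ true
  ball-step G k x z y b lt a = ∨-true⁺ʳ (Ball G k x y) (anyBelow-complete M _ z lt (∧-true⁺ b a))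

  ball-inv : ∀ G k x y → Ball G (suc k) x y ≡ true →
    Ball G k x y ≡ true ⊎ Σ[ z ∈ ℕ ] (z < M × Ball G k x z ≡ true × adjG G z y ≡ true)
  ball-inv G k x y e with ∨-true⁻ {Ball G k x y} e
  ... | inj₁ b = inj₁ b
  ... | inj₂ a with anyBelow-sound M _ a
  ... | z , lt , q = inj₂ (z , lt , ∧-true⁻ˡ q , ∧-true⁻ʳ q)

  ball-mono : ∀ G k j x y → k ≤ j → Ball G k x y ≡ true → Ball G j x y ≡ true
  ball-mono G k zero x y z≤n e = e
  ball-mono G k (suc j) x y le e with m≤n⇒m<n∨m≡n le
  ... | inj₁ lt = ball-s G j x y (ball-mono G k j x y (≤-pred lt) e)
  ... | inj₂ refl = e

  ball-tri : ∀ G a b x y z → Ball G b x y ≡ true → Ball G a y z ≡ true → Ball G (b + a) x z ≡ true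
  ball-tri G zero b x y z e1 e2 rewrite +-identityʳ b | ball-0 G y z e2 = e1
  ball-tri G (suc a) b x y z e1 e2 rewrite +-suc b a with ball-inv G a y z e2
  ... | inj₁ q = ball-s G (b + a) x z (ball-tri G a b x y z e1 q)
  ... | inj₂ (w , lt , q , adj) = ball-step G (b + a) x w z (ball-tri G a b x y w e1 q) lt adj

  ball-sym : ∀ G → (∀ a b → adjG G a b ≡ adjG G b a) → (∀ a b → adjG G a b ≡ true → a < M) →
             ∀ k x y → Ball G k x y ≡ true → Ball G k y x ≡ true
  ball-sym G sy bd zero x y e rewrite ≡ᵇ-sym x y = e
  ball-sym G sy bd (suc k) x y e with ball-inv G k x y e
  ... | inj₁ q = ball-s G k y x (ball-sym G sy bd k x y q)
  ... | inj₂ (z , lt , q , adj) =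
    ball-tri G k 1 y z x (ball-step G 0 y y z (≡ᵇ-refl y) (bd y z (trans (sy y z) adj)) (trans (sy y z) adj))
      (ball-sym G sy bd k x z q)

  Agree : IdGraph → IdGraph → ℕ → ℕ → Set
  Agree G H r x = ∀ y → Ball G r x y ≡ true →
    (inSG G y ≡ inSG H y) × (∀ z → adjG G y z ≡ adjG H y z)

  agree-mono : ∀ G H r r' x → r' ≤ r → Agree G H r x → Agree G H r' x
  agree-mono G H r r' x le ag y b = ag y (ball-mono G r' r x y le b)

  agree-sub : ∀ G H a r x y → Agree G H (a + r) x → Ball G a x y ≡ true → Agree G H r y
  agree-sub G H a r x y ag b z bz = ag z (ball-tri G r a x y z b bz)

  ball-agree : ∀ G H r x → Agree G H r x → ∀ k → k ≤ suc r → ∀ y → Ball G k x y ≡ Ball H k x y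
  ball-agree G H r x ag zero le y = refl
  ball-agree G H r x ag (suc k) le y =
    cong₂ _∨_ (ball-agree G H r x ag k (≤-trans (n≤1+n k) le) y)
      (anyBelow-cong M _ _ λ z _ → lem z)
    where
    lem : ∀ z → (Ball G k x z ∧ adjG G z y) ≡ (Ball H k x z ∧ adjG H z y)
    lem z with Ball G k x z in e | ball-agree G H r x ag k (≤-trans (n≤1+n k) le) z
    ... | true | q rewrite sym q = cong (true ∧_) (proj₂ (ag z (ball-mono G k r x z (≤-pred le) e)) y)
    ... | false | q rewrite sym q = refl

  Local : ∀ {A : Set} → ℕ → (IdGraph → ℕ → A) → Set
  Local r F = ∀ G H x → Agree G H r x → F G x ≡ F H x

  local-mono : ∀ {A : Set} r r' (F : IdGraph → ℕ → A) → r ≤ r' → Local r F → Local r' F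
  local-mono r r' F le runOn-local G H x ag = runOn-local G H x (agree-mono G H r' r x le ag)

-- The clustering algorithm

-- A record (c , p , d): the node belongs to the Steiner tree of cluster c, at depth d, with
-- parent p. A node's label is the identifier of the centre of its current cluster, and
-- stopped marks a red cluster that has stopped growing in the current phase.
TreeRecord : Set
TreeRecord = ℕ × ℕ × ℕ

record NodeState : Set where
  constructor state
  field
    alive   : Bool
    label   : ℕ
    stopped : Bool
    records : List TreeRecord
open NodeState public

findRecord : ℕ → List TreeRecord → Maybe (ℕ × ℕ)
findRecord c [] = nothing
findRecord c ((c' , p , d) ∷ rs) = if (c ≡ᵇ c') then just (p , d) else findRecord c rs

hasRecord : ℕ → List TreeRecord → Bool
hasRecord c rs = is-just (findRecord c rs)

recordDepth : Maybe (ℕ × ℕ) → ℕ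
recordDepth (just (p , d)) = d
recordDepth nothing = 0

recordParent : Maybe (ℕ × ℕ) → ℕ
recordParent (just (p , d)) = p
recordParent nothing = 0

depthIn : ℕ → List TreeRecord → ℕ
depthIn c rs = recordDepth (findRecord c rs)

parentIn : ℕ → List TreeRecord → ℕ
parentIn c rs = recordParent (findRecord c rs)

addRecord : ℕ → ℕ → ℕ → List TreeRecord → List TreeRecord
addRecord c p d rs = if hasRecord c rs then rs else (c , p , d) ∷ rs

hasRecord⇒found : ∀ c rs → hasRecord c rs ≡ true → Σ[ p ∈ ℕ ] Σ[ d ∈ ℕ ] findRecord c rs ≡ just (p , d)
hasRecord⇒found c rs e with findRecord c rs
... | just (p , d) = p , d , refl
hasRecord⇒found c rs () | nothing

found⇒hasRecord : ∀ c rs {x} → findRecord c rs ≡ just x → hasRecord c rs ≡ true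
found⇒hasRecord c rs e rewrite e = refl

found⇒depthIn : ∀ c rs {p d} → findRecord c rs ≡ just (p , d) → depthIn c rs ≡ d
found⇒depthIn c rs e rewrite e = refl

addRecord-preserves : ∀ c c' p d rs {x} → findRecord c rs ≡ just x → findRecord c (addRecord c' p d rs) ≡ just x
addRecord-preserves c c' p d rs {x} e with hasRecord c' rs in eh
... | true = e
... | false with c ≡ᵇ c' in ec
... | true rewrite ≡ᵇ-sound c c' ec = ⊥-elim (true≢false (found⇒hasRecord c' rs e) eh)
... | false = e

addRecord-found⁻ : ∀ c c' p d rs {x} → findRecord c (addRecord c' p d rs) ≡ just x →
  findRecord c rs ≡ just x ⊎ (c ≡ c' × hasRecord c' rs ≡ false × x ≡ (p , d))
addRecord-found⁻ c c' p d rs e with hasRecord c' rs in eh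
... | true = inj₁ e
... | false with c ≡ᵇ c' in ec
... | true = inj₂ (≡ᵇ-sound c c' ec , refl , sym (just-injective e))
... | false = inj₁ e

hasRecord-addRecord : ∀ c p d rs → hasRecord c (addRecord c p d rs) ≡ true
hasRecord-addRecord c p d rs with hasRecord c rs in eh
... | true = eh
... | false rewrite ≡ᵇ-refl c = refl

length-addRecord : ∀ c p d rs → length (addRecord c p d rs) ≤ suc (length rs)
length-addRecord c p d rs with hasRecord c rs
... | true = n≤1+n _
... | false = ≤-refl

hasRecord⇒∈ : ∀ c rs → hasRecord c rs ≡ true → c ∈ map proj₁ rs
hasRecord⇒∈ c [] ()
hasRecord⇒∈ c ((c' , p , d) ∷ rs) h with c ≡ᵇ c' in e
... | true = here (≡ᵇ-sound c c' e)
... | false = there (hasRecord⇒∈ c rs h)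

isRed : ℕ → ℕ → Bool
isRed k c = odd (dropBits k c)

prefix : ℕ → ℕ → ℕ
prefix k c = dropBits (suc k) c

aliveBlue : ℕ → NodeState → Bool
aliveBlue k s = alive s ∧ not (isRed k (label s))

aliveRed : ℕ → NodeState → Bool
aliveRed k s = alive s ∧ isRed k (label s)

aliveRed⇒red : ∀ k s → aliveRed k s ≡ true → isRed k (label s) ≡ true
aliveRed⇒red k s e = ∧-true⁻ʳ {alive s} e

aliveRed⇒alive : ∀ k s → aliveRed k s ≡ true → alive s ≡ true
aliveRed⇒alive k s e = ∧-true⁻ˡ {alive s} e

aliveBlue⇒alive : ∀ k s → aliveBlue k s ≡ true → alive s ≡ true
aliveBlue⇒alive k s e = ∧-true⁻ˡ {alive s} e

aliveBlue⇒notRed : ∀ k s → aliveBlue k s ≡ true → isRed k (label s) ≡ false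
aliveBlue⇒notRed k s e = not-true⁻ (∧-true⁻ʳ {alive s} e)

notRed⇒aliveBlue : ∀ k s → alive s ≡ true → isRed k (label s) ≡ false → aliveBlue k s ≡ true
notRed⇒aliveBlue k s a r rewrite a | r = refl

red⇒aliveRed : ∀ k s → alive s ≡ true → isRed k (label s) ≡ true → aliveRed k s ≡ true
red⇒aliveRed k s a r rewrite a | r = refl

red-blue-disjoint : ∀ k s → aliveRed k s ≡ true → aliveBlue k s ≡ true → ⊥
red-blue-disjoint k s r b = true≢false (aliveRed⇒red k s r) (aliveBlue⇒notRed k s b)

joinCluster : NodeState → ℕ → NodeState → NodeState
joinCluster s z sz = state (alive s) (label sz) false (addRecord (label sz) z (suc (depthIn (label sz) (records sz))) (records s))

kill : NodeState → NodeState
kill s = state false (label s) (stopped s) (records s)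

blueUpdate : NodeState → Maybe (ℕ × NodeState) → Bool → NodeState
blueUpdate s nothing aT = s
blueUpdate s (just (z , sz)) aT = if aT then joinCluster s z sz else kill s

updateNode : ℕ → NodeState → Maybe (ℕ × NodeState) → Bool → Bool → NodeState
updateNode k s mt aT aO =
  if aliveBlue k s then blueUpdate s mt aT
  else (if (aliveRed k s ∧ not (stopped s)) then state (alive s) (label s) (not aO) (records s) else s)

withState : (ℕ → NodeState) → Maybe ℕ → Maybe (ℕ × NodeState)
withState σ nothing = nothing
withState σ (just z) = just (z , σ z)

proposesTo : (ℕ → NodeState) → Maybe ℕ → ℕ → Bool
proposesTo σ nothing c = false
proposesTo σ (just z) c = label (σ z) ≡ᵇ c

iterate : ℕ → ((ℕ → NodeState) → (ℕ → NodeState)) → (ℕ → NodeState) → (ℕ → NodeState)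
iterate zero f σ = σ
iterate (suc t) f σ = f (iterate t f σ)

unstopAll : (ℕ → NodeState) → (ℕ → NodeState)
unstopAll σ y = state (alive (σ y)) (label (σ y)) false (records (σ y))

initial : IdGraph → ℕ → NodeState
initial G y = state (inSG G y) y false (if inSG G y then (y , y , 0) ∷ [] else [])

module Clustering (M ρ K T : ℕ) where
  open Balls M public

  eligible : ℕ → IdGraph → (ℕ → NodeState) → ℕ → ℕ → Bool
  eligible k G σ y z = adjG G y z ∧ (alive (σ z) ∧ (isRed k (label (σ z)) ∧ (not (stopped (σ z)) ∧
                     (prefix k (label (σ z)) ≡ᵇ prefix k (label (σ y))))))

  target : ℕ → IdGraph → (ℕ → NodeState) → ℕ → Maybe ℕ
  target k G σ y = if aliveBlue k (σ y) then firstBelow M (eligible k G σ y) else nothing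

  ballSize : IdGraph → (ℕ → NodeState) → ℕ → ℕ → ℕ
  ballSize G σ x c = countBelow M (λ z → Ball G ρ x z ∧ (alive (σ z) ∧ (label (σ z) ≡ᵇ c)))

  ballProposals : ℕ → IdGraph → (ℕ → NodeState) → ℕ → ℕ → ℕ
  ballProposals k G σ x c = countBelow M (λ z → Ball G ρ x z ∧ proposesTo σ (target k G σ z) c)

  accepts : ℕ → IdGraph → (ℕ → NodeState) → ℕ → ℕ → Bool
  accepts k G σ x c = ballSize G σ x c ≤ᵇ K * ballProposals k G σ x c

  acceptsTarget : ℕ → IdGraph → (ℕ → NodeState) → ℕ → Maybe ℕ → Bool
  acceptsTarget k G σ y nothing = false
  acceptsTarget k G σ y (just z) = accepts k G σ y (label (σ z))

  stepAll : ℕ → IdGraph → (ℕ → NodeState) → (ℕ → NodeState)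
  stepAll k G σ y = if (y <ᵇ M) then
    updateNode k (σ y) (withState σ (target k G σ y)) (acceptsTarget k G σ y (target k G σ y)) (accepts k G σ y (label (σ y)))
    else σ y

  phase : ℕ → IdGraph → (ℕ → NodeState) → (ℕ → NodeState)
  phase k G σ = iterate T (stepAll k G) (unstopAll σ)

  phases : ℕ → IdGraph → (ℕ → NodeState) → (ℕ → NodeState)
  phases zero G σ = σ
  phases (suc k) G σ = phases k G (phase k G σ)

  final : ℕ → IdGraph → ℕ → NodeState
  final B G = phases B G (initial G)

  initial-local : Local 0 initial
  initial-local G H x ag rewrite proj₁ (ag x (≡ᵇ-refl x)) = refl

  unstopAll-local : ∀ r F → Local r F → Local r (λ G → unstopAll (F G))
  unstopAll-local r F runOn-local G H x ag rewrite runOn-local G H x ag = refl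

  step-local : ∀ k r F → Local r F → Local (suc ρ + r) (λ G → stepAll k G (F G))
  step-local k r F runOn-local G H x ag with x <ᵇ M in ex
  ... | false = runOn-local G H x (agree-mono G H (suc ρ + r) r x (m≤n+m r (suc ρ)) ag)
  ... | true = updateNodeEq
    where
    σ = F G
    τ = F H
    xM : x < M
    xM = ≤ᵇ-sound (suc x) M ex
    eqσ : ∀ y → Ball G (suc ρ) x y ≡ true → σ y ≡ τ y
    eqσ y b = runOn-local G H y (agree-sub G H (suc ρ) r x y ag b)
    rows : ∀ y → Ball G (suc ρ) x y ≡ true → ∀ z → adjG G y z ≡ adjG H y z
    rows y b = proj₂ (ag y (ball-mono G (suc ρ) (suc ρ + r) x y (m≤m+n (suc ρ) r) b))
    ballEq : ∀ z → Ball G ρ x z ≡ Ball H ρ x z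
    ballEq = ball-agree G H (suc ρ + r) x ag ρ (≤-trans (n≤1+n ρ) (≤-trans (m≤m+n (suc ρ) r) (n≤1+n _)))
    inρ : ∀ z → Ball G ρ x z ≡ true → Ball G (suc ρ) x z ≡ true
    inρ z b = ball-s G ρ x z b
    nb : ∀ z w → Ball G ρ x z ≡ true → z < M → adjG G z w ≡ true → Ball G (suc ρ) x w ≡ true
    nb z w b zM a = ball-step G ρ x z w b zM a

    eligibleEq : ∀ z → Ball G ρ x z ≡ true → z < M → ∀ w → eligible k G σ z w ≡ eligible k H τ z w
    eligibleEq z b zM w with adjG G z w in ea
    ... | false rewrite sym (rows z (inρ z b) w) | ea = refl
    ... | true rewrite sym (rows z (inρ z b) w) | ea | eqσ w (nb z w b zM ea) | eqσ z (inρ z b) = refl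

    targetEq : ∀ z → Ball G ρ x z ≡ true → z < M → target k G σ z ≡ target k H τ z
    targetEq z b zM rewrite firstBelow-cong M (eligible k G σ z) (eligible k H τ z) (λ w _ → eligibleEq z b zM w)
      | eqσ z (inρ z b) = refl

    proposesToEq : ∀ z → z < M → ∀ c →
      (Ball G ρ x z ∧ proposesTo σ (target k G σ z) c) ≡ (Ball H ρ x z ∧ proposesTo τ (target k H τ z) c)
    proposesToEq z zM c with Ball G ρ x z in eb
    ... | false rewrite sym (ballEq z) | eb = refl
    ... | true rewrite sym (ballEq z) | eb | sym (targetEq z eb zM) with target k G σ z in et
    ... | nothing = refl
    ... | just w with aliveBlue k (σ z)
    ... | true rewrite eqσ w (nb z w eb zM (∧-true⁻ˡ (proj₂ (firstBelow-sound M _ w et)))) = refl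
    ... | false with et
    ... | ()

    memEq : ∀ z → z < M → ∀ c → (Ball G ρ x z ∧ (alive (σ z) ∧ (label (σ z) ≡ᵇ c))) ≡
                                (Ball H ρ x z ∧ (alive (τ z) ∧ (label (τ z) ≡ᵇ c)))
    memEq z zM c with Ball G ρ x z in eb
    ... | false rewrite sym (ballEq z) | eb = refl
    ... | true rewrite sym (ballEq z) | eb | eqσ z (inρ z eb) = refl

    accEq : ∀ c → accepts k G σ x c ≡ accepts k H τ x c
    accEq c rewrite countBelow-cong M _ _ (λ z zM → memEq z zM c) | countBelow-cong M _ _ (λ z zM → proposesToEq z zM c) = refl

    xb : Ball G ρ x x ≡ true
    xb = ball-refl G ρ x

    target⇒first : ∀ {w} → (if aliveBlue k (σ x) then firstBelow M (eligible k G σ x) else nothing) ≡ just w →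
      firstBelow M (eligible k G σ x) ≡ just w
    target⇒first e with aliveBlue k (σ x)
    ... | true = e
    target⇒first () | false

    updateNodeEq : updateNode k (σ x) (withState σ (target k G σ x)) (acceptsTarget k G σ x (target k G σ x)) (accepts k G σ x (label (σ x)))
         ≡ updateNode k (τ x) (withState τ (target k H τ x)) (acceptsTarget k H τ x (target k H τ x)) (accepts k H τ x (label (τ x)))
    updateNodeEq rewrite sym (targetEq x xb xM) | accEq (label (σ x)) with target k G σ x in et
    ... | nothing rewrite eqσ x (inρ x xb) = refl
    ... | just w rewrite accEq (label (σ w)) | eqσ w (nb x w xb xM (∧-true⁻ˡ (proj₂ (firstBelow-sound M _ w (target⇒first et)))))
                       | eqσ x (inρ x xb) = refl

  iterate-local : ∀ k t r F → Local r F → Local (t * suc ρ + r) (λ G → iterate t (stepAll k G) (F G))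
  iterate-local k zero r F runOn-local = runOn-local
  iterate-local k (suc t) r F runOn-local =
    local-mono _ _ _ (≤-reflexive (sym (+-assoc (suc ρ) (t * suc ρ) r)))
      (step-local k (t * suc ρ + r) (λ G → iterate t (stepAll k G) (F G)) (iterate-local k t r F runOn-local))

  phase-local : ∀ k r F → Local r F → Local (T * suc ρ + r) (λ G → phase k G (F G))
  phase-local k r F runOn-local = iterate-local k T r (λ G → unstopAll (F G)) (unstopAll-local r F runOn-local)

  phases-local : ∀ k r F → Local r F → Local (k * (T * suc ρ) + r) (λ G → phases k G (F G))
  phases-local zero r F runOn-local = runOn-local
  phases-local (suc k) r F runOn-local =
    local-mono _ _ _ (≤-reflexive (trans (sym (+-assoc (k * (T * suc ρ)) (T * suc ρ) r))
                                          (cong (_+ r) (+-comm (k * (T * suc ρ)) (T * suc ρ)))))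
      (phases-local k (T * suc ρ + r) (λ G → phase k G (F G)) (phase-local k r F runOn-local))

  final-local : ∀ B → Local (B * (T * suc ρ) + 0) (final B)
  final-local B = phases-local B 0 initial initial-local

findFin : ∀ {n} → (Fin n → Bool) → Maybe (Fin n)
findFin {zero} f = nothing
findFin {suc n} f with f Fin.zero
... | true = just Fin.zero
... | false with findFin {n} (λ i → f (Fin.suc i))
... | just i = just (Fin.suc i)
... | nothing = nothing

findFin-sound : ∀ {n} (f : Fin n → Bool) u → findFin f ≡ just u → f u ≡ true
findFin-sound {suc n} f u e with f Fin.zero in e0
findFin-sound {suc n} f u refl | true = e0
... | false with findFin {n} (λ i → f (Fin.suc i)) in e1
findFin-sound {suc n} f u refl | false | just i = findFin-sound (λ i → f (Fin.suc i)) i e1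
findFin-sound {suc n} f u () | false | nothing

findFin-complete : ∀ {n} (f : Fin n → Bool) u → f u ≡ true → Σ[ v ∈ Fin n ] findFin f ≡ just v
findFin-complete {suc n} f u e with f Fin.zero in e0
... | true = Fin.zero , refl
... | false with findFin {n} (λ i → f (Fin.suc i)) in e1
... | just i = Fin.suc i , refl
findFin-complete {suc n} f Fin.zero e | false | nothing = ⊥-elim (true≢false e e0)
findFin-complete {suc n} f (Fin.suc u) e | false | nothing with findFin-complete (λ i → f (Fin.suc i)) u e
... | v , q = ⊥-elim (just≢nothing q e1)

module IdGraphOf {n} (I : Instance n) where

  nodeOf : ℕ → Maybe (Fin n)
  nodeOf y = findFin (λ u → (ident I u ≡ᵇ y))

  nodeOf-sound : ∀ y u → nodeOf y ≡ just u → ident I u ≡ y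
  nodeOf-sound y u e = ≡ᵇ-sound _ _ (findFin-sound _ u e)

  nodeOf-ident : ∀ u → nodeOf (ident I u) ≡ just u
  nodeOf-ident u with findFin-complete (λ v → (ident I v ≡ᵇ ident I u)) u (≡ᵇ-refl (ident I u))
  ... | v , e rewrite e = cong just (ident-inj I v u (nodeOf-sound _ v e))

  adjM : Maybe (Fin n) → Maybe (Fin n) → Bool
  adjM (just u) (just v) = adj I u v
  adjM _ _ = false

  inSM : Maybe (Fin n) → Bool
  inSM (just u) = inS I u
  inSM nothing = false

  G : IdGraph
  G = idGraph (λ y z → adjM (nodeOf y) (nodeOf z)) (λ y → inSM (nodeOf y))

  adj-id : ∀ u v → adjG G (ident I u) (ident I v) ≡ adj I u v
  adj-id u v rewrite nodeOf-ident u | nodeOf-ident v = refl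

  inS-id : ∀ u → inSG G (ident I u) ≡ inS I u
  inS-id u rewrite nodeOf-ident u = refl

  adj-inv : ∀ y z → adjG G y z ≡ true →
    Σ[ u ∈ Fin n ] Σ[ v ∈ Fin n ] (ident I u ≡ y × ident I v ≡ z × adj I u v ≡ true)
  adj-inv y z e with nodeOf y in e1 | nodeOf z in e2
  ... | just u | just v = u , v , nodeOf-sound y u e1 , nodeOf-sound z v e2 , e
  adj-inv y z () | just u | nothing
  adj-inv y z () | nothing | _

  inS-inv : ∀ y → inSG G y ≡ true → Σ[ u ∈ Fin n ] (ident I u ≡ y × inS I u ≡ true)
  inS-inv y e with nodeOf y in e1
  ... | just u = u , nodeOf-sound y u e1 , e
  inS-inv y () | nothing

  adjG-sym : ∀ a b → adjG G a b ≡ adjG G b a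
  adjG-sym a b with nodeOf a | nodeOf b
  ... | just u | just v = adj-sym I u v
  ... | just u | nothing = refl
  ... | nothing | just v = refl
  ... | nothing | nothing = refl

  adjG⇒NbrId : ∀ u z → adjG G (ident I u) z ≡ true → NbrId I u z
  adjG⇒NbrId u z e with adj-inv (ident I u) z e
  ... | a , b , ea , eb , ad rewrite ident-inj I a u ea = b , ad , eb

  Walk-snoc : ∀ {v u w k} → Walk I v u k → adj I u w ≡ true → Walk I v w (suc k)
  Walk-snoc here a = step a here
  Walk-snoc (step a' p) a = step a' (Walk-snoc p a)

  module _ (M : ℕ) where
    open Balls M

    Ball⇒Walk : ∀ k v y → Ball G k (ident I v) y ≡ true →
      Σ[ u ∈ Fin n ] (ident I u ≡ y × WithinDist I k v u)
    Ball⇒Walk zero v y e = v , ≡ᵇ-sound _ _ e , 0 , z≤n , here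
    Ball⇒Walk (suc k) v y e with ball-inv G k (ident I v) y e
    ... | inj₁ q with Ball⇒Walk k v y q
    ... | u , eu , j , j≤k , p = u , eu , j , ≤-trans j≤k (n≤1+n k) , p
    Ball⇒Walk (suc k) v y e | inj₂ (z , _ , q , a) with Ball⇒Walk k v z q | adj-inv z y a
    ... | u , eu , j , j≤k , p | a1 , b1 , ea1 , eb1 , ad
      rewrite ident-inj I a1 u (trans ea1 (sym eu)) =
      b1 , eb1 , suc j , s≤s j≤k , Walk-snoc p ad

module ViewAgree {n} (I J : Instance n) (M : ℕ) where
  open Balls M
  open IdGraphOf I
  private module BJ = IdGraphOf J

  view-agree : ∀ R v w → SameView R I v J w → Agree G BJ.G R (ident I v)
  view-agree R v w (_ , incl , _) y b with Ball⇒Walk M R v y b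
  ... | u , refl , wd with incl u wd
  ... | u' , _ , (eid , eS , enb) =
    trans (inS-id u) (trans eS (trans (sym (BJ.inS-id u')) (cong (inSG BJ.G) (sym eid)))) ,
    λ z → bool-ext (f z) (g z)
    where
    f : ∀ z → adjG G (ident I u) z ≡ true → adjG BJ.G (ident I u) z ≡ true
    f z e with Equivalence.to (enb z) (adjG⇒NbrId u z e)
    ... | b' , ad , refl rewrite eid = trans (BJ.adj-id u' b') ad
    g : ∀ z → adjG BJ.G (ident I u) z ≡ true → adjG G (ident I u) z ≡ true
    g z e with Equivalence.from (enb z) (BJ.adjG⇒NbrId u' z (subst (λ t → adjG BJ.G t z ≡ true) eid e))
    ... | b' , ad , refl = trans (adj-id u b') ad

-- Invariants of the run

module Invariants (M ρ K T Dmax : ℕ) (G : IdGraph)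
  (symG : ∀ a b → adjG G a b ≡ adjG G b a)
  (adjB : ∀ a b → adjG G a b ≡ true → a < M)
  (inSB : ∀ y → inSG G y ≡ true → y < M)
  (ρ-big : suc Dmax + suc Dmax ≤ ρ)
  where
  open Clustering M ρ K T

  clusterSize : (ℕ → NodeState) → ℕ → ℕ
  clusterSize σ c = countBelow M (λ z → alive (σ z) ∧ (label (σ z) ≡ᵇ c))

  proposals : ℕ → (ℕ → NodeState) → ℕ → ℕ
  proposals k σ c = countBelow M (λ z → proposesTo σ (target k G σ z) c)

  accepted : ℕ → (ℕ → NodeState) → ℕ → Bool
  accepted k σ c = clusterSize σ c ≤ᵇ K * proposals k σ c

  aliveCount : (ℕ → NodeState) → ℕ
  aliveCount τ = countBelow M (λ y → alive (τ y))

  stoppedCount : ℕ → (ℕ → NodeState) → ℕ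
  stoppedCount k τ = countBelow M (λ y → aliveRed k (τ y) ∧ stopped (τ y))

  RecordJustified : (ℕ → NodeState) → ℕ → ℕ → ℕ → ℕ → Set
  RecordJustified σ y c p d = (y ≡ c × d ≡ 0) ⊎
    (Σ[ d' ∈ ℕ ] (d ≡ suc d' × adjG G p y ≡ true × Σ[ p' ∈ ℕ ] findRecord c (records (σ p)) ≡ just (p' , d')))

  record Invariant (t : ℕ) (σ : ℕ → NodeState) : Set where
    field
      alive⇒living : ∀ y → alive (σ y) ≡ true → inSG G y ≡ true
      alive⇒ownRecord : ∀ y → alive (σ y) ≡ true → hasRecord (label (σ y)) (records (σ y)) ≡ true
      record-justified : ∀ y c p d → findRecord c (records (σ y)) ≡ just (p , d) → d ≤ t × RecordJustified σ y c p d
      centre-depth0 : ∀ c p d → findRecord c (records (σ c)) ≡ just (p , d) → d ≡ 0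
      record⇒centreLiving : ∀ y c → hasRecord c (records (σ y)) ≡ true → inSG G c ≡ true
      living⇒selfRecord : ∀ y → inSG G y ≡ true → hasRecord y (records (σ y)) ≡ true
      record⇒living : ∀ y c → hasRecord c (records (σ y)) ≡ true → inSG G y ≡ true
  open Invariant public

  target⇒eligible : ∀ k σ y z → target k G σ y ≡ just z →
    aliveBlue k (σ y) ≡ true × z < M × eligible k G σ y z ≡ true
  target⇒eligible k σ y z e with aliveBlue k (σ y) in eb
  ... | true = refl , firstBelow-sound M _ z e
  target⇒eligible k σ y z () | false

  record Eligible (k : ℕ) (σ : ℕ → NodeState) (y z : ℕ) : Set where
    field
      e-adj : adjG G y z ≡ true
      e-alive : alive (σ z) ≡ true
      e-red : isRed k (label (σ z)) ≡ true
      e-unstopped : stopped (σ z) ≡ false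
      e-prefix : prefix k (label (σ z)) ≡ prefix k (label (σ y))
  open Eligible public

  eligible⁻ : ∀ k σ y z → eligible k G σ y z ≡ true → Eligible k σ y z
  eligible⁻ k σ y z e = record
    { e-adj = ∧-true⁻ˡ {adjG G y z} e ; e-alive = ∧-true⁻ˡ {alive (σ z)} e2 ; e-red = ∧-true⁻ˡ {isRed k (label (σ z))} e3
    ; e-unstopped = not-true⁻ (∧-true⁻ˡ {not (stopped (σ z))} e4) ; e-prefix = ≡ᵇ-sound _ _ (∧-true⁻ʳ {not (stopped (σ z))} e4) }
    where
    e2 = ∧-true⁻ʳ {adjG G y z} e
    e3 = ∧-true⁻ʳ {alive (σ z)} e2
    e4 = ∧-true⁻ʳ {isRed k (label (σ z))} e3

  eligible⁺ : ∀ k σ y z → Eligible k σ y z → eligible k G σ y z ≡ true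
  eligible⁺ k σ y z q rewrite e-adj q | e-alive q | e-red q | e-unstopped q | e-prefix q | ≡ᵇ-refl (prefix k (label (σ y))) = refl

  updateNode-blue : ∀ k s mt aT aO → aliveBlue k s ≡ true → updateNode k s mt aT aO ≡ blueUpdate s mt aT
  updateNode-blue k s mt aT aO e rewrite e = refl

  updateNode-red : ∀ k s mt aT aO → aliveBlue k s ≡ false → (aliveRed k s ∧ not (stopped s)) ≡ true →
    updateNode k s mt aT aO ≡ state (alive s) (label s) (not aO) (records s)
  updateNode-red k s mt aT aO e1 e2 rewrite e1 | e2 = refl

  updateNode-other : ∀ k s mt aT aO → aliveBlue k s ≡ false → (aliveRed k s ∧ not (stopped s)) ≡ false →
    updateNode k s mt aT aO ≡ s
  updateNode-other k s mt aT aO e1 e2 rewrite e1 | e2 = refl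

  module UnderInvariant {t : ℕ} {σ : ℕ → NodeState} (gi : Invariant t σ) (tD : t ≤ Dmax) where

    record⇒Ball : ∀ d y c p → findRecord c (records (σ y)) ≡ just (p , d) → Ball G d c y ≡ true
    record⇒Ball d y c p e with record-justified gi y c p d e
    ... | _ , inj₁ (refl , refl) = ≡ᵇ-refl y
    record⇒Ball (suc d') y c p e | _ , inj₂ (.d' , refl , a , p' , e') =
      ball-step G d' c p y (record⇒Ball d' p c p' e') (adjB p y a) a

    member-ball : ∀ y c → alive (σ y) ≡ true → label (σ y) ≡ c →
      Σ[ d ∈ ℕ ] (d ≤ Dmax × Ball G d c y ≡ true)
    member-ball y c al refl with hasRecord⇒found (label (σ y)) (records (σ y)) (alive⇒ownRecord gi y al)
    ... | p , d , e = d , ≤-trans (proj₁ (record-justified gi y (label (σ y)) p d e)) tD , record⇒Ball d y (label (σ y)) p e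

    proposer-Ball : ∀ k y z c → target k G σ y ≡ just z → label (σ z) ≡ c →
      Σ[ d ∈ ℕ ] (d ≤ suc Dmax × Ball G d c y ≡ true)
    proposer-Ball k y z c e lz with target⇒eligible k σ y z e
    ... | _ , zM , q with member-ball z c (e-alive (eligible⁻ k σ y z q)) lz
    ... | d , dD , b = suc d , s≤s dD ,
          ball-step G d c z y b zM (trans (symG z y) (e-adj (eligible⁻ k σ y z q)))

    ball-sym′ : ∀ d a b → Ball G d a b ≡ true → Ball G d b a ≡ true
    ball-sym′ d a b = ball-sym G symG adjB d a b

    -- Members and proposers of cluster c lie within distance Dmax + 1 of its centre, so within
    -- distance ρ of x: the counts over the ρ-ball of x are the global ones.
    accepts≡accepted : ∀ k x c e → Ball G e x c ≡ true → e ≤ suc Dmax → accepts k G σ x c ≡ accepted k σ c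
    accepts≡accepted k x c e bx le = cong₂ (λ a b → (a ≤ᵇ K * b))
        (countBelow-cong M _ _ (λ z _ → memEq z)) (countBelow-cong M _ _ (λ z _ → propEq z))
      where
      inρ : ∀ d z → d ≤ suc Dmax → Ball G d c z ≡ true → Ball G ρ x z ≡ true
      inρ d z dl b = ball-mono G (e + d) ρ x z (≤-trans (+-mono-≤ le dl) ρ-big) (ball-tri G d e x c z bx b)
      memEq : ∀ z → (Ball G ρ x z ∧ (alive (σ z) ∧ (label (σ z) ≡ᵇ c))) ≡ (alive (σ z) ∧ (label (σ z) ≡ᵇ c))
      memEq z with alive (σ z) ∧ (label (σ z) ≡ᵇ c) in em
      ... | false = ∧-zeroʳ _
      ... | true with member-ball z c (∧-true⁻ˡ {alive (σ z)} em) (≡ᵇ-sound _ _ (∧-true⁻ʳ {alive (σ z)} em))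
      ... | d , dD , b rewrite inρ d z (≤-trans dD (n≤1+n Dmax)) b = refl
      propEq : ∀ z → (Ball G ρ x z ∧ proposesTo σ (target k G σ z) c) ≡ proposesTo σ (target k G σ z) c
      propEq z with target k G σ z in et
      ... | nothing = ∧-zeroʳ _
      ... | just w with label (σ w) ≡ᵇ c in el
      ... | false = ∧-zeroʳ _
      ... | true with proposer-Ball k z w c et (≡ᵇ-sound _ _ el)
      ... | d , dD , b rewrite inρ d z dD b = refl

    data StepCase (k y : ℕ) (s' : NodeState) : Set where
      stays : aliveBlue k (σ y) ≡ true → target k G σ y ≡ nothing → s' ≡ σ y → StepCase k y s'
      joins : ∀ z → target k G σ y ≡ just z → accepted k σ (label (σ z)) ≡ true →
              s' ≡ joinCluster (σ y) z (σ z) → StepCase k y s'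
      dies  : ∀ z → target k G σ y ≡ just z → accepted k σ (label (σ z)) ≡ false →
              s' ≡ kill (σ y) → StepCase k y s'
      redUpdate  : aliveBlue k (σ y) ≡ false → aliveRed k (σ y) ≡ true → stopped (σ y) ≡ false →
              s' ≡ state (alive (σ y)) (label (σ y)) (not (accepted k σ (label (σ y)))) (records (σ y)) → StepCase k y s'
      untouched : aliveBlue k (σ y) ≡ false → (aliveRed k (σ y) ∧ not (stopped (σ y))) ≡ false →
                  s' ≡ σ y → StepCase k y s'

    stepCase : ∀ k y → StepCase k y (stepAll k G σ y)
    stepCase k y with y <ᵇ M in ey
    ... | false = untouched bf rf refl
      where
      dead : alive (σ y) ≡ false
      dead with alive (σ y) in ea
      ... | false = refl
      ... | true = ⊥-elim (true≢false (<⇒leb (inSB y (alive⇒living gi y ea))) ey)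
        where
        <⇒leb : ∀ {a b} → a < b → (suc a ≤ᵇ b) ≡ true
        <⇒leb lt = Equivalence.to T-≡ (≤⇒≤ᵇ lt)
      bf : aliveBlue k (σ y) ≡ false
      bf rewrite dead = refl
      rf : (aliveRed k (σ y) ∧ not (stopped (σ y))) ≡ false
      rf rewrite dead = refl
    ... | true = caseOnTarget (target k G σ y) refl
      where
      caseOnTarget : ∀ tn → target k G σ y ≡ tn →
        StepCase k y (updateNode k (σ y) (withState σ tn) (acceptsTarget k G σ y tn) (accepts k G σ y (label (σ y))))
      caseOnTarget tn et = caseOnColour (aliveBlue k (σ y)) refl
        where
        caseBlue : ∀ tn → target k G σ y ≡ tn → aliveBlue k (σ y) ≡ true →
          StepCase k y (blueUpdate (σ y) (withState σ tn) (acceptsTarget k G σ y tn))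
        caseBlue nothing et eb = stays eb et refl
        caseBlue (just z) et eb with proposer-Ball k y z (label (σ z)) et refl
        ... | d , dD , b rewrite accepts≡accepted k y (label (σ z)) d (ball-sym′ d _ _ b) dD with accepted k σ (label (σ z)) in ea
        ... | true = joins z et ea refl
        ... | false = dies z et ea refl
        caseNotBlue : ∀ b → (aliveRed k (σ y) ∧ not (stopped (σ y))) ≡ b → aliveBlue k (σ y) ≡ false →
          StepCase k y (updateNode k (σ y) (withState σ tn) (acceptsTarget k G σ y tn) (accepts k G σ y (label (σ y))))
        caseNotBlue true er eb with member-ball y (label (σ y)) (∧-true⁻ˡ {alive (σ y)} (∧-true⁻ˡ {aliveRed k (σ y)} er)) refl
        ... | d , dD , b rewrite updateNode-red k (σ y) (withState σ tn) (acceptsTarget k G σ y tn) (accepts k G σ y (label (σ y))) eb er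
                         | accepts≡accepted k y (label (σ y)) d (ball-sym′ d _ _ b) (≤-trans dD (n≤1+n Dmax)) =
          redUpdate eb (∧-true⁻ˡ {aliveRed k (σ y)} er) (not-true⁻ (∧-true⁻ʳ {aliveRed k (σ y)} er)) refl
        caseNotBlue false er eb rewrite updateNode-other k (σ y) (withState σ tn) (acceptsTarget k G σ y tn) (accepts k G σ y (label (σ y))) eb er =
          untouched eb er refl
        caseOnColour : ∀ b → aliveBlue k (σ y) ≡ b →
          StepCase k y (updateNode k (σ y) (withState σ tn) (acceptsTarget k G σ y tn) (accepts k G σ y (label (σ y))))
        caseOnColour true eb rewrite updateNode-blue k (σ y) (withState σ tn) (acceptsTarget k G σ y tn) (accepts k G σ y (label (σ y))) eb =
          caseBlue tn et eb
        caseOnColour false eb = caseNotBlue _ refl eb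

    records-step : ∀ k y → (records (stepAll k G σ y) ≡ records (σ y)) ⊎
      (Σ[ z ∈ ℕ ] (target k G σ y ≡ just z ×
         records (stepAll k G σ y) ≡ addRecord (label (σ z)) z (suc (depthIn (label (σ z)) (records (σ z)))) (records (σ y))))
    records-step k y with stepCase k y
    ... | stays _ _ e rewrite e = inj₁ refl
    ... | joins z et _ e rewrite e = inj₂ (z , et , refl)
    ... | dies _ _ _ e rewrite e = inj₁ refl
    ... | redUpdate _ _ _ e rewrite e = inj₁ refl
    ... | untouched _ _ e rewrite e = inj₁ refl

    alive-step⁻¹ : ∀ k y → alive (stepAll k G σ y) ≡ true → alive (σ y) ≡ true
    alive-step⁻¹ k y a with stepCase k y
    ... | stays _ _ e rewrite e = a
    ... | joins z et _ e rewrite e = a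
    ... | dies _ _ _ e rewrite e = ⊥-elim (true≢false a refl)
    ... | redUpdate _ _ _ e rewrite e = a
    ... | untouched _ _ e rewrite e = a

    findRecord-step : ∀ k y c {x} → findRecord c (records (σ y)) ≡ just x →
      findRecord c (records (stepAll k G σ y)) ≡ just x
    findRecord-step k y c e with records-step k y
    ... | inj₁ r rewrite r = e
    ... | inj₂ (z , _ , r) rewrite r = addRecord-preserves c (label (σ z)) z (suc (depthIn (label (σ z)) (records (σ z)))) (records (σ y)) e

    findRecord-step⁻ : ∀ k y c {x} → findRecord c (records (stepAll k G σ y)) ≡ just x →
      findRecord c (records (σ y)) ≡ just x ⊎
      Σ[ z ∈ ℕ ] (target k G σ y ≡ just z × c ≡ label (σ z) × hasRecord c (records (σ y)) ≡ false ×
                  x ≡ (z , suc (depthIn c (records (σ z)))))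
    findRecord-step⁻ k y c l with records-step k y
    ... | inj₁ r = inj₁ (trans (sym (cong (findRecord c) r)) l)
    ... | inj₂ (z , et , r)
      with addRecord-found⁻ c (label (σ z)) z (suc (depthIn (label (σ z)) (records (σ z)))) (records (σ y))
             (trans (sym (cong (findRecord c) r)) l)
    ... | inj₁ old = inj₁ old
    ... | inj₂ (refl , nh , refl) = inj₂ (z , et , refl , nh , refl)

    hasRecord-step : ∀ k y c → hasRecord c (records (σ y)) ≡ true → hasRecord c (records (stepAll k G σ y)) ≡ true
    hasRecord-step k y c h with hasRecord⇒found c (records (σ y)) h
    ... | p , d , e = found⇒hasRecord c (records (stepAll k G σ y)) (findRecord-step k y c e)

    justified-step : ∀ k y c p d → RecordJustified σ y c p d → RecordJustified (stepAll k G σ) y c p d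
    justified-step k y c p d (inj₁ x) = inj₁ x
    justified-step k y c p d (inj₂ (d' , e , a , p' , l)) = inj₂ (d' , e , a , p' , findRecord-step k p c l)

    invariant-step : ∀ k → Invariant (suc t) (stepAll k G σ)
    invariant-step k .alive⇒living y a = alive⇒living gi y (alive-step⁻¹ k y a)
    invariant-step k .alive⇒ownRecord y a with stepCase k y
    ... | stays _ _ e rewrite e = alive⇒ownRecord gi y a
    ... | joins z et _ e rewrite e = hasRecord-addRecord (label (σ z)) z (suc (depthIn (label (σ z)) (records (σ z)))) (records (σ y))
    ... | dies _ _ _ e rewrite e = ⊥-elim (true≢false a refl)
    ... | redUpdate _ _ _ e rewrite e = alive⇒ownRecord gi y a
    ... | untouched _ _ e rewrite e = alive⇒ownRecord gi y a
    invariant-step k .record-justified y c p d l with findRecord-step⁻ k y c l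
    ... | inj₁ old = let (a , b) = record-justified gi y c p d old in m≤n⇒m≤1+n a , justified-step k y c p d b
    ... | inj₂ (z , et , refl , _ , refl) with target⇒eligible k σ y z et
    ... | _ , zM , q with hasRecord⇒found (label (σ z)) (records (σ z)) (alive⇒ownRecord gi z (e-alive (eligible⁻ k σ y z q)))
    ... | p' , d0 , lz rewrite found⇒depthIn (label (σ z)) (records (σ z)) lz =
      s≤s (proj₁ (record-justified gi z _ p' d0 lz)) ,
      inj₂ (d0 , refl , trans (symG z y) (e-adj (eligible⁻ k σ y z q)) , p' , findRecord-step k z _ lz)
    invariant-step k .centre-depth0 c p d l with findRecord-step⁻ k c c l
    ... | inj₁ old = centre-depth0 gi c p d old
    ... | inj₂ (z , et , _ , nh , _) with target⇒eligible k σ c z et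
    ... | bA , _ = ⊥-elim (true≢false (living⇒selfRecord gi c (alive⇒living gi c (aliveBlue⇒alive k (σ c) bA))) nh)
    invariant-step k .record⇒centreLiving y c h with hasRecord⇒found c (records (stepAll k G σ y)) h
    ... | p , d , l with findRecord-step⁻ k y c l
    ... | inj₁ old = record⇒centreLiving gi y c (found⇒hasRecord c (records (σ y)) old)
    ... | inj₂ (z , et , refl , _ , _) with target⇒eligible k σ y z et
    ... | _ , _ , q = record⇒centreLiving gi z _ (alive⇒ownRecord gi z (e-alive (eligible⁻ k σ y z q)))
    invariant-step k .living⇒selfRecord y i = hasRecord-step k y y (living⇒selfRecord gi y i)
    invariant-step k .record⇒living y c h with hasRecord⇒found c (records (stepAll k G σ y)) h
    ... | p , d , l with findRecord-step⁻ k y c l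
    ... | inj₁ old = record⇒living gi y c (found⇒hasRecord c (records (σ y)) old)
    ... | inj₂ (z , et , _) with target⇒eligible k σ y z et
    ... | bA , _ = alive⇒living gi y (aliveBlue⇒alive k (σ y) bA)

  invariant-unstopAll : ∀ {t σ} → Invariant t σ → Invariant t (unstopAll σ)
  invariant-unstopAll gi = record { Invariant gi }

  invariant-initial : Invariant 0 (initial G)
  invariant-initial .alive⇒living y a = a
  invariant-initial .alive⇒ownRecord y a rewrite a | ≡ᵇ-refl y = refl
  invariant-initial .record-justified y c p d l with inSG G y
  invariant-initial .record-justified y c p d l | true with c ≡ᵇ y in e
  invariant-initial .record-justified y c p d refl | true | true = z≤n , inj₁ (sym (≡ᵇ-sound c y e) , refl)
  invariant-initial .record-justified y c p d () | true | false
  invariant-initial .record-justified y c p d () | false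
  invariant-initial .centre-depth0 c p d l with inSG G c
  invariant-initial .centre-depth0 c p d l | true rewrite ≡ᵇ-refl c with l
  ... | refl = refl
  invariant-initial .centre-depth0 c p d () | false
  invariant-initial .record⇒centreLiving y c h with inSG G y in ei
  invariant-initial .record⇒centreLiving y c h | true with c ≡ᵇ y in e
  ... | true rewrite ≡ᵇ-sound c y e = ei
  invariant-initial .record⇒centreLiving y c () | true | false
  invariant-initial .record⇒centreLiving y c () | false
  invariant-initial .living⇒selfRecord y i rewrite i | ≡ᵇ-refl y = refl
  invariant-initial .record⇒living y c h with inSG G y
  ... | true = refl
  invariant-initial .record⇒living y c () | false

module StepLemmas (M ρ K T Dmax : ℕ) (G : IdGraph)
  (symG : ∀ a b → adjG G a b ≡ adjG G b a)
  (adjB : ∀ a b → adjG G a b ≡ true → a < M)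
  (inSB : ∀ y → inSG G y ≡ true → y < M)
  (ρ-big : suc Dmax + suc Dmax ≤ ρ)
  where
  open Clustering M ρ K T
  open Invariants M ρ K T Dmax G symG adjB inSB ρ-big public

  RedStepCase : ℕ → (ℕ → NodeState) → ℕ → Set
  RedStepCase k σ x =
    (aliveRed k (σ x) ≡ true × label (stepAll k G σ x) ≡ label (σ x) ×
       stopped (stepAll k G σ x) ≡ (stopped (σ x) ∨ not (accepted k σ (label (σ x))))) ⊎
    (Σ[ z ∈ ℕ ] (target k G σ x ≡ just z × accepted k σ (label (σ z)) ≡ true ×
       label (stepAll k G σ x) ≡ label (σ z) × stopped (stepAll k G σ x) ≡ false))

  module StepAt (k : ℕ) {t : ℕ} {σ : ℕ → NodeState} (gi : Invariant t σ) (tD : t ≤ Dmax) where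
    open UnderInvariant gi tD public

    σ' : ℕ → NodeState
    σ' = stepAll k G σ

    label<M : ∀ y → alive (σ y) ≡ true → label (σ y) < M
    label<M y a = inSB _ (record⇒centreLiving gi y _ (alive⇒ownRecord gi y a))

    blue-step⁻¹ : ∀ y → aliveBlue k (σ' y) ≡ true →
      aliveBlue k (σ y) ≡ true × target k G σ y ≡ nothing × σ' y ≡ σ y
    blue-step⁻¹ y b with stepCase k y
    ... | stays bb et e = bb , et , e
    ... | joins z et _ e rewrite e with target⇒eligible k σ y z et
    ... | bb , _ , q = ⊥-elim (true≢false (e-red (eligible⁻ k σ y z q)) (aliveBlue⇒notRed k (joinCluster (σ y) z (σ z)) b))
    blue-step⁻¹ y b | dies z et _ e rewrite e = ⊥-elim (true≢false b refl)
    blue-step⁻¹ y b | redUpdate _ ra _ e rewrite e = ⊥-elim (red-blue-disjoint k (σ y) ra b)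
    blue-step⁻¹ y b | untouched bf _ e rewrite e = ⊥-elim (true≢false b bf)

    red-step⁻¹ : ∀ x → alive (σ' x) ≡ true → isRed k (label (σ' x)) ≡ true → RedStepCase k σ x
    red-step⁻¹ x a r with stepCase k x
    ... | stays bb _ e rewrite e = ⊥-elim (true≢false r (aliveBlue⇒notRed k (σ x) bb))
    ... | joins z et ac e rewrite e = inj₂ (z , et , ac , refl , refl)
    ... | dies z et _ e rewrite e = ⊥-elim (true≢false a refl)
    ... | redUpdate _ ra sf e rewrite e | sf = inj₁ (ra , refl , refl)
    ... | untouched bf of e rewrite e = inj₁ (ra , refl , lem)
      where
      ra : aliveRed k (σ x) ≡ true
      ra = red⇒aliveRed k (σ x) a r
      lem : stopped (σ x) ≡ (stopped (σ x) ∨ not (accepted k σ (label (σ x))))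
      lem = helper (stopped (σ x)) refl
        where
        helper : ∀ b → stopped (σ x) ≡ b → stopped (σ x) ≡ (stopped (σ x) ∨ not (accepted k σ (label (σ x))))
        helper true es rewrite es = refl
        helper false es = ⊥-elim (true≢false (∧-true⁺ ra (not-true⁺ es)) of)

    prefix-step : ∀ y → alive (σ' y) ≡ true → prefix k (label (σ' y)) ≡ prefix k (label (σ y))
    prefix-step y a with stepCase k y
    ... | stays _ _ e rewrite e = refl
    ... | joins z et _ e rewrite e = e-prefix (eligible⁻ k σ y z (proj₂ (proj₂ (target⇒eligible k σ y z et))))
    ... | dies _ _ _ e rewrite e = ⊥-elim (true≢false a refl)
    ... | redUpdate _ _ _ e rewrite e = refl
    ... | untouched _ _ e rewrite e = refl

    aliveRed-step : ∀ x → aliveRed k (σ x) ≡ true → aliveRed k (σ' x) ≡ true × label (σ' x) ≡ label (σ x)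
    aliveRed-step x ra with stepCase k x
    ... | stays bb _ _ = ⊥-elim (red-blue-disjoint k (σ x) ra bb)
    ... | joins z et _ _ = ⊥-elim (red-blue-disjoint k (σ x) ra (proj₁ (target⇒eligible k σ x z et)))
    ... | dies z et _ _ = ⊥-elim (red-blue-disjoint k (σ x) ra (proj₁ (target⇒eligible k σ x z et)))
    ... | redUpdate _ _ _ e rewrite e = ra , refl
    ... | untouched _ _ e rewrite e = ra , refl

    join-succeeds : ∀ y z → target k G σ y ≡ just z → accepted k σ (label (σ z)) ≡ true →
      alive (σ' y) ≡ true × label (σ' y) ≡ label (σ z)
    join-succeeds y z et ac with stepCase k y
    ... | stays _ et' _ = ⊥-elim (just≢nothing et et')
    ... | joins z' et' _ e rewrite e with trans (sym et) et'
    ... | refl = aliveBlue⇒alive k (σ y) (proj₁ (target⇒eligible k σ y z et)) , refl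
    join-succeeds y z et ac | dies z' et' ac' _ with trans (sym et) et'
    ... | refl = ⊥-elim (true≢false ac ac')
    join-succeeds y z et ac | redUpdate bf _ _ _ = ⊥-elim (true≢false (proj₁ (target⇒eligible k σ y z et)) bf)
    join-succeeds y z et ac | untouched bf _ _ = ⊥-elim (true≢false (proj₁ (target⇒eligible k σ y z et)) bf)

    rejected-stops : ∀ x → aliveRed k (σ x) ≡ true → stopped (σ x) ≡ false → accepted k σ (label (σ x)) ≡ false →
      aliveRed k (σ' x) ≡ true × stopped (σ' x) ≡ true
    rejected-stops x ra sf ac with stepCase k x
    ... | stays bb _ _ = ⊥-elim (red-blue-disjoint k (σ x) ra bb)
    ... | joins z et _ _ = ⊥-elim (red-blue-disjoint k (σ x) ra (proj₁ (target⇒eligible k σ x z et)))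
    ... | dies z et _ _ = ⊥-elim (red-blue-disjoint k (σ x) ra (proj₁ (target⇒eligible k σ x z et)))
    ... | redUpdate _ _ _ e rewrite e | ac = ra , refl
    ... | untouched _ of _ = ⊥-elim (true≢false (∧-true⁺ ra (not-true⁺ sf)) of)

    stopped-fixed : ∀ x → aliveRed k (σ x) ≡ true → stopped (σ x) ≡ true → σ' x ≡ σ x
    stopped-fixed x ra sT with stepCase k x
    ... | stays bb _ _ = ⊥-elim (red-blue-disjoint k (σ x) ra bb)
    ... | joins z et _ _ = ⊥-elim (red-blue-disjoint k (σ x) ra (proj₁ (target⇒eligible k σ x z et)))
    ... | dies z et _ _ = ⊥-elim (red-blue-disjoint k (σ x) ra (proj₁ (target⇒eligible k σ x z et)))
    ... | redUpdate _ _ sf _ = ⊥-elim (true≢false sT sf)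
    ... | untouched _ _ e = e

    rejectedM : Maybe ℕ → Bool
    rejectedM (just z) = not (accepted k σ (label (σ z)))
    rejectedM nothing = false

    targetLabelM : Maybe ℕ → ℕ
    targetLabelM (just z) = label (σ z)
    targetLabelM nothing = 0

    rejected : ℕ → Bool
    rejected y = rejectedM (target k G σ y)

    targetLabel : ℕ → ℕ
    targetLabel y = targetLabelM (target k G σ y)

    rejected⁻ : ∀ y → rejected y ≡ true →
      Σ[ z ∈ ℕ ] (target k G σ y ≡ just z × accepted k σ (label (σ z)) ≡ false × targetLabel y ≡ label (σ z))
    rejected⁻ y r = h (target k G σ y) refl r
      where
      h : ∀ tn → target k G σ y ≡ tn → rejectedM tn ≡ true →
        Σ[ z ∈ ℕ ] (target k G σ y ≡ just z × accepted k σ (label (σ z)) ≡ false × targetLabelM (target k G σ y) ≡ label (σ z))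
      h (just z) et r rewrite et = z , refl , not-true⁻ r , refl
      h nothing et ()

    death⇒rejected : ∀ y → alive (σ y) ≡ true → alive (σ' y) ≡ false → rejected y ≡ true
    death⇒rejected y a na with stepCase k y
    ... | stays _ _ e rewrite e = ⊥-elim (true≢false a na)
    ... | joins z et _ e rewrite e = ⊥-elim (true≢false a na)
    ... | dies z et ac _ = trans (cong rejectedM et) (cong not ac)
    ... | redUpdate _ _ _ e rewrite e = ⊥-elim (true≢false a na)
    ... | untouched _ _ e rewrite e = ⊥-elim (true≢false a na)

    accepted-grows : ∀ c → accepted k σ c ≡ true → isRed k c ≡ true →
      (∀ x → alive (σ x) ≡ true → label (σ x) ≡ c → stopped (σ x) ≡ false) →
      clusterSize σ c + proposals k σ c ≤ clusterSize σ' c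
    accepted-grows c ac rc allns =
      ≤-trans (≤-reflexive (sym (countBelow-∨ M _ _ proposersNotMembers)))
        (countBelow-mono M _ _ lem)
      where
      proposersNotMembers : ∀ y → (alive (σ y) ∧ (label (σ y) ≡ᵇ c)) ≡ true →
        proposesTo σ (target k G σ y) c ≡ true → ⊥
      proposersNotMembers y m p with target k G σ y in et
      proposersNotMembers y m () | nothing
      ... | just z with target⇒eligible k σ y z et
      ... | bb , _ = true≢false (subst (λ w → isRed k w ≡ true) (sym (≡ᵇ-sound _ _ (∧-true⁻ʳ {alive (σ y)} m))) rc)
                         (aliveBlue⇒notRed k (σ y) bb)
      lem : ∀ y → y < M → ((alive (σ y) ∧ (label (σ y) ≡ᵇ c)) ∨ proposesTo σ (target k G σ y) c) ≡ true →
            (alive (σ' y) ∧ (label (σ' y) ≡ᵇ c)) ≡ true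
      lem y _ h with ∨-true⁻ {alive (σ y) ∧ (label (σ y) ≡ᵇ c)} h
      ... | inj₁ m with ≡ᵇ-sound _ _ (∧-true⁻ʳ {alive (σ y)} m)
      ... | lc with aliveRed-step y (red⇒aliveRed k (σ y) (∧-true⁻ˡ {alive (σ y)} m) (subst (λ w → isRed k w ≡ true) (sym lc) rc))
      ... | ra' , l' = ∧-true⁺ (aliveRed⇒alive k (σ' y) ra') (subst (λ w → (w ≡ᵇ c) ≡ true) (sym l') (∧-true⁻ʳ {alive (σ y)} m))
      lem y _ h | inj₂ p = hj (target k G σ y) refl p
        where
        hj : ∀ tn → target k G σ y ≡ tn → proposesTo σ tn c ≡ true →
          (alive (σ' y) ∧ (label (σ' y) ≡ᵇ c)) ≡ true
        hj nothing et ()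
        hj (just z) et p with join-succeeds y z et (subst (λ w → accepted k σ w ≡ true) (sym (≡ᵇ-sound (label (σ z)) c p)) ac)
        ... | a' , l' rewrite l' = ∧-true⁺ a' p

    newlyStopped : ℕ → Bool
    newlyStopped y = aliveRed k (σ y) ∧ (not (stopped (σ y)) ∧ not (accepted k σ (label (σ y))))

    dying : ℕ → Bool
    dying y = alive (σ y) ∧ not (alive (σ' y))

    aliveSplit : aliveCount σ ≡ aliveCount σ' + countBelow M dying
    aliveSplit = trans (countBelow-cong M _ _ alive-or-dying) (countBelow-∨ M _ _ dj)
      where
      alive-or-dying : ∀ y → y < M → alive (σ y) ≡ (alive (σ' y) ∨ dying y)
      alive-or-dying y _ with alive (σ' y) in e'
      ... | true rewrite alive-step⁻¹ k y e' = refl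
      ... | false with alive (σ y)
      ... | true = refl
      ... | false = refl
      dj : ∀ y → alive (σ' y) ≡ true → dying y ≡ true → ⊥
      dj y a d = true≢false a (not-true⁻ (∧-true⁻ʳ {alive (σ y)} d))

    dying≤rejected : countBelow M dying ≤ countBelow M rejected
    dying≤rejected = countBelow-mono M _ _ (λ y _ d → death⇒rejected y (∧-true⁻ˡ {alive (σ y)} d) (not-true⁻ (∧-true⁻ʳ {alive (σ y)} d)))

    stoppedCount-step : stoppedCount k σ + countBelow M newlyStopped ≤ stoppedCount k σ'
    stoppedCount-step = ≤-trans (≤-reflexive (sym (countBelow-∨ M _ _ dj))) (countBelow-mono M _ _ lem)
      where
      dj : ∀ y → (aliveRed k (σ y) ∧ stopped (σ y)) ≡ true → newlyStopped y ≡ true → ⊥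
      dj y a b = true≢false (∧-true⁻ʳ {aliveRed k (σ y)} a) (not-true⁻ (∧-true⁻ˡ {not (stopped (σ y))} (∧-true⁻ʳ {aliveRed k (σ y)} b)))
      lem : ∀ y → y < M → ((aliveRed k (σ y) ∧ stopped (σ y)) ∨ newlyStopped y) ≡ true →
        (aliveRed k (σ' y) ∧ stopped (σ' y)) ≡ true
      lem y _ h with ∨-true⁻ {aliveRed k (σ y) ∧ stopped (σ y)} h
      ... | inj₁ a rewrite stopped-fixed y (∧-true⁻ˡ {aliveRed k (σ y)} a) (∧-true⁻ʳ {aliveRed k (σ y)} a) = a
      ... | inj₂ b with rejected-stops y (∧-true⁻ˡ {aliveRed k (σ y)} b) (not-true⁻ (∧-true⁻ˡ {not (stopped (σ y))} (∧-true⁻ʳ {aliveRed k (σ y)} b)))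
                               (not-true⁻ (∧-true⁻ʳ {not (stopped (σ y))} (∧-true⁻ʳ {aliveRed k (σ y)} b)))
      ... | r1 , r2 = ∧-true⁺ r1 r2

    module _ (unif : ∀ x x' → alive (σ x) ≡ true → alive (σ x') ≡ true → label (σ x) ≡ label (σ x') →
                     stopped (σ x) ≡ stopped (σ x')) where

      rejecting-members-stop : ∀ c y0 z0 → target k G σ y0 ≡ just z0 → label (σ z0) ≡ c →
        accepted k σ c ≡ false → ∀ y → y < M → (alive (σ y) ∧ (label (σ y) ≡ᵇ c)) ≡ true →
        (newlyStopped y ∧ (label (σ y) ≡ᵇ c)) ≡ true
      rejecting-members-stop c y0 z0 et lz ea y _ h =
        ∧-true⁺ (∧-true⁺ ra (∧-true⁺ (not-true⁺ sf) (not-true⁺ (subst (λ w → accepted k σ w ≡ false) (sym ly) ea))))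
                (∧-true⁻ʳ {alive (σ y)} h)
        where
        qi = eligible⁻ k σ y0 z0 (proj₂ (proj₂ (target⇒eligible k σ y0 z0 et)))
        ly : label (σ y) ≡ c
        ly = ≡ᵇ-sound _ _ (∧-true⁻ʳ {alive (σ y)} h)
        ra : aliveRed k (σ y) ≡ true
        ra = red⇒aliveRed k (σ y) (∧-true⁻ˡ {alive (σ y)} h) (subst (λ w → isRed k w ≡ true) (trans lz (sym ly)) (e-red qi))
        sf : stopped (σ y) ≡ false
        sf = trans (unif y z0 (∧-true⁻ˡ {alive (σ y)} h) (e-alive qi) (trans ly (sym lz))) (e-unstopped qi)

      rejected-per-label : ∀ c → K * countBelow M (λ y → rejected y ∧ (targetLabel y ≡ᵇ c)) ≤
                                 countBelow M (λ y → newlyStopped y ∧ (label (σ y) ≡ᵇ c))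
      rejected-per-label c with accepted k σ c in ea
      ... | true = ≤-trans (≤-reflexive (cong (K *_) (n≤0⇒n≡0 (≤-trans (countBelow-mono M _ (λ _ → false) none)
                              (≤-reflexive (sumBelow-zero M _ (λ _ _ → refl)))))))
                     (≤-trans (≤-reflexive (*-zeroʳ K)) z≤n)
        where
        none : ∀ y → y < M → (rejected y ∧ (targetLabel y ≡ᵇ c)) ≡ true → false ≡ true
        none y _ h with rejected⁻ y (∧-true⁻ˡ {rejected y} h)
        ... | z , et , ac , tle = ⊥-elim (true≢false ea (subst (λ w → accepted k σ w ≡ false)
               (trans (sym tle) (≡ᵇ-sound _ _ (∧-true⁻ʳ {rejected y} h))) ac))
      ... | false = ≤-trans (*-monoʳ-≤ K rejected≤proposals) K*proposals≤
        where
        rejected≤proposals : countBelow M (λ y → rejected y ∧ (targetLabel y ≡ᵇ c)) ≤ proposals k σ c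
        rejected≤proposals = countBelow-mono M _ _ proposes
          where
          proposes : ∀ y → y < M → (rejected y ∧ (targetLabel y ≡ᵇ c)) ≡ true →
            proposesTo σ (target k G σ y) c ≡ true
          proposes y _ h with rejected⁻ y (∧-true⁻ˡ {rejected y} h)
          ... | z , et , ac , tle =
            trans (cong (λ tn → proposesTo σ tn c) et) (trans (cong (_≡ᵇ c) (sym tle)) (∧-true⁻ʳ {rejected y} h))
        K*proposals≤ : K * proposals k σ c ≤ countBelow M (λ y → newlyStopped y ∧ (label (σ y) ≡ᵇ c))
        K*proposals≤ with proposals k σ c in ep
        ... | zero = ≤-trans (≤-reflexive (*-zeroʳ K)) z≤n
        ... | suc p with countBelow-witness M (λ z → proposesTo σ (target k G σ z) c) (subst (1 ≤_) (sym ep) (s≤s z≤n))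
        ... | y0 , _ , m0 = fromProposer (target k G σ y0) refl m0
          where
          fromProposer : ∀ tn → target k G σ y0 ≡ tn → proposesTo σ tn c ≡ true →
            K * suc p ≤ countBelow M (λ y → newlyStopped y ∧ (label (σ y) ≡ᵇ c))
          fromProposer nothing _ ()
          fromProposer (just z0) et m0 =
            ≤-trans (<⇒≤ (≤ᵇ-false (clusterSize σ c) (K * suc p) ea))
              (countBelow-mono M _ _ (rejecting-members-stop c y0 z0 et (≡ᵇ-sound _ _ m0)
                (subst (λ w → (clusterSize σ c ≤ᵇ K * w) ≡ false) (sym ep) ea)))

      rejected≤newlyStopped : K * countBelow M rejected ≤ countBelow M newlyStopped
      rejected≤newlyStopped = ≤-trans (≤-reflexive (trans (cong (K *_) part1) (sumBelow-* M K _)))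
                    (≤-trans (sumBelow-mono M (λ c _ → rejected-per-label c)) (≤-reflexive (sym part2)))
        where
        part1 : countBelow M rejected ≡ sumBelow M (λ c → countBelow M (λ y → rejected y ∧ (targetLabel y ≡ᵇ c)))
        part1 = countBelow-partition M M rejected targetLabel bnd
          where
          bnd : ∀ y → y < M → rejected y ≡ true → targetLabel y < M
          bnd y _ r with rejected⁻ y r
          ... | z , et , _ , tle rewrite tle = label<M z (e-alive (eligible⁻ k σ y z (proj₂ (proj₂ (target⇒eligible k σ y z et)))))
        part2 : countBelow M newlyStopped ≡ sumBelow M (λ c → countBelow M (λ y → newlyStopped y ∧ (label (σ y) ≡ᵇ c)))
        part2 = countBelow-partition M M newlyStopped (λ y → label (σ y)) (λ y _ n → label<M y (aliveRed⇒alive k (σ y) (∧-true⁻ˡ {aliveRed k (σ y)} n)))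

      -- Every death is paid for by K nodes that stop, so K · alive + stopped never decreases.
      potential-step : K * aliveCount σ + stoppedCount k σ ≤ K * aliveCount σ' + stoppedCount k σ'
      potential-step = begin
        K * aliveCount σ + stoppedCount k σ
          ≡⟨ cong (λ w → K * w + stoppedCount k σ) aliveSplit ⟩
        K * (aliveCount σ' + countBelow M dying) + stoppedCount k σ
          ≡⟨ cong (_+ stoppedCount k σ) (*-distribˡ-+ K (aliveCount σ') (countBelow M dying)) ⟩
        K * aliveCount σ' + K * countBelow M dying + stoppedCount k σ
          ≤⟨ +-monoˡ-≤ (stoppedCount k σ) (+-monoʳ-≤ (K * aliveCount σ')
               (≤-trans (*-monoʳ-≤ K dying≤rejected) rejected≤newlyStopped)) ⟩
        K * aliveCount σ' + countBelow M newlyStopped + stoppedCount k σ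
          ≡⟨ +-assoc (K * aliveCount σ') (countBelow M newlyStopped) (stoppedCount k σ) ⟩
        K * aliveCount σ' + (countBelow M newlyStopped + stoppedCount k σ)
          ≤⟨ +-monoʳ-≤ (K * aliveCount σ')
               (≤-trans (≤-reflexive (+-comm (countBelow M newlyStopped) (stoppedCount k σ))) stoppedCount-step) ⟩
        K * aliveCount σ' + stoppedCount k σ' ∎
        where open ≤-Reasoning

  target-blue : ∀ k σ y → aliveBlue k (σ y) ≡ true → target k G σ y ≡ firstBelow M (eligible k G σ y)
  target-blue k σ y e rewrite e = refl

  growth-step : ∀ X Y b c p → b ≤ K * p → b + p ≤ c → X ≤ b * Y → suc K * X ≤ c * (K * Y)
  growth-step X Y b c p h1 h2 h3 = begin
    suc K * X ≤⟨ *-monoʳ-≤ (suc K) h3 ⟩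
    suc K * (b * Y) ≡⟨ sym (*-assoc (suc K) b Y) ⟩
    suc K * b * Y ≤⟨ *-monoˡ-≤ Y lem ⟩
    K * c * Y ≡⟨ cong (_* Y) (*-comm K c) ⟩
    c * K * Y ≡⟨ *-assoc c K Y ⟩
    c * (K * Y) ∎
    where
    open ≤-Reasoning
    lem : suc K * b ≤ K * c
    lem = begin
      b + K * b ≤⟨ +-monoˡ-≤ (K * b) h1 ⟩
      K * p + K * b ≡⟨ sym (*-distribˡ-+ K p b) ⟩
      K * (p + b) ≤⟨ *-monoʳ-≤ K (≤-trans (≤-reflexive (+-comm p b)) h2) ⟩
      K * c ∎

module PhaseLemmas (M ρ K T Dmax : ℕ) (G : IdGraph)
  (symG : ∀ a b → adjG G a b ≡ adjG G b a)
  (adjB : ∀ a b → adjG G a b ≡ true → a < M)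
  (inSB : ∀ y → inSG G y ≡ true → y < M)
  (ρ-big : suc Dmax + suc Dmax ≤ ρ)
  (grow : M * K ^ T < suc K ^ T)
  where
  open Clustering M ρ K T
  open StepLemmas M ρ K T Dmax G symG adjB inSB ρ-big public

  PrefixAgree : ℕ → (ℕ → NodeState) → Set
  PrefixAgree j τ = ∀ x y → alive (τ x) ≡ true → alive (τ y) ≡ true → adjG G x y ≡ true →
               dropBits j (label (τ x)) ≡ dropBits j (label (τ y))

  module PhaseRun (k : ℕ) {t0 : ℕ} {σ : ℕ → NodeState} (gi0 : Invariant t0 σ) (tT : t0 + T ≤ Dmax)
               (pinv : PrefixAgree (suc k) σ) (L0 : ℕ) (records≤ : ∀ y → length (records (σ y)) ≤ L0) where

    states : ℕ → ℕ → NodeState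
    states s = iterate s (stepAll k G) (unstopAll σ)

    tb : ∀ s → s ≤ T → t0 + s ≤ Dmax
    tb s le = ≤-trans (+-monoʳ-≤ t0 le) tT

    invariant-states : ∀ s → s ≤ T → Invariant (t0 + s) (states s)
    invariant-states zero _ = subst (λ t → Invariant t (unstopAll σ)) (sym (+-identityʳ t0)) (invariant-unstopAll gi0)
    invariant-states (suc s) le = subst (λ t → Invariant t (states (suc s))) (sym (+-suc t0 s))
      (UnderInvariant.invariant-step (invariant-states s (≤-trans (n≤1+n s) le)) (tb s (≤-trans (n≤1+n s) le)) k)

    module S (s : ℕ) (le : suc s ≤ T) = StepAt k (invariant-states s (≤-trans (n≤1+n s) le)) (tb s (≤-trans (n≤1+n s) le))

    alive-origin : ∀ s → s ≤ T → ∀ y → alive (states s y) ≡ true →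
      alive (σ y) ≡ true × prefix k (label (states s y)) ≡ prefix k (label (σ y))
    alive-origin zero _ y a = a , refl
    alive-origin (suc s) le y a = let (a0 , p0) = alive-origin s (≤-trans (n≤1+n s) le) y (S.alive-step⁻¹ s le k y a) in
      a0 , trans (S.prefix-step s le y a) p0

    blue-unstopped : ∀ s → s ≤ T → ∀ y → aliveBlue k (states s y) ≡ true → stopped (states s y) ≡ false
    blue-unstopped zero _ y b = refl
    blue-unstopped (suc s) le y b with S.blue-step⁻¹ s le y b
    ... | bb , _ , e rewrite e = blue-unstopped s (≤-trans (n≤1+n s) le) y bb

    stopped-uniform : ∀ s → s ≤ T → ∀ x x' → alive (states s x) ≡ true → alive (states s x') ≡ true →
         label (states s x) ≡ label (states s x') → stopped (states s x) ≡ stopped (states s x')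
    stopped-uniform zero _ x x' a a' l = refl
    stopped-uniform (suc s) le x x' a a' l = byColour (isRed k (label (states (suc s) x))) refl
      where
      le' = ≤-trans (n≤1+n s) le
      σ1 = states (suc s)
      σ0 = states s
      IH = stopped-uniform s le'
      byColour : ∀ r → isRed k (label (σ1 x)) ≡ r → stopped (σ1 x) ≡ stopped (σ1 x')
      byColour false e = trans (blue-unstopped (suc s) le x (notRed⇒aliveBlue k (σ1 x) a e))
                   (sym (blue-unstopped (suc s) le x' (notRed⇒aliveBlue k (σ1 x') a' (trans (cong (isRed k) (sym l)) e))))
      byColour true e = combine (S.red-step⁻¹ s le x a e) (S.red-step⁻¹ s le x' a' (trans (cong (isRed k) (sym l)) e))
        where
        redAndJoined : ∀ u v → label (σ1 u) ≡ label (σ1 v) →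
          (aliveRed k (σ0 u) ≡ true × label (σ1 u) ≡ label (σ0 u) ×
                   stopped (σ1 u) ≡ (stopped (σ0 u) ∨ not (accepted k σ0 (label (σ0 u))))) →
          (Σ[ z ∈ ℕ ] (target k G σ0 v ≡ just z × accepted k σ0 (label (σ0 z)) ≡ true ×
                   label (σ1 v) ≡ label (σ0 z) × stopped (σ1 v) ≡ false)) → stopped (σ1 u) ≡ stopped (σ1 v)
        redAndJoined u v luv (ra , lu , su) (z , et , ac , lz , sz) =
          trans su (trans (cong₂ (λ p q → p ∨ not q) (trans ihz (e-unstopped qi)) (trans (cong (accepted k σ0) luz) ac)) (sym sz))
          where
          qi = eligible⁻ k σ0 v z (proj₂ (proj₂ (target⇒eligible k σ0 v z et)))
          luz : label (σ0 u) ≡ label (σ0 z)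
          luz = trans (sym lu) (trans luv lz)
          ihz = IH u z (aliveRed⇒alive k (σ0 u) ra) (e-alive qi) luz
        combine : RedStepCase k σ0 x → RedStepCase k σ0 x' → stopped (σ1 x) ≡ stopped (σ1 x')
        combine (inj₁ (ra , lx , sx)) (inj₁ (ra' , lx' , sx')) =
          trans sx (trans (cong₂ (λ p q → p ∨ not (accepted k σ0 q))
            (IH x x' (aliveRed⇒alive k (σ0 x) ra) (aliveRed⇒alive k (σ0 x') ra') lxx) lxx) (sym sx'))
          where lxx = trans (sym lx) (trans l lx')
        combine (inj₁ cx) (inj₂ cx') = redAndJoined x x' l cx cx'
        combine (inj₂ cx) (inj₁ cx') = sym (redAndJoined x' x (sym l) cx' cx)
        combine (inj₂ (_ , _ , _ , _ , sz)) (inj₂ (_ , _ , _ , _ , sz')) = trans sz (sym sz')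

    red-next-to-blue-unstopped : ∀ s → s ≤ T → ∀ x y →
      aliveRed k (states s x) ≡ true → aliveBlue k (states s y) ≡ true → adjG G x y ≡ true →
         stopped (states s x) ≡ false
    red-next-to-blue-unstopped zero _ x y _ _ _ = refl
    red-next-to-blue-unstopped (suc s) le x y ra bl ad =
      h (S.blue-step⁻¹ s le y bl) (S.red-step⁻¹ s le x (aliveRed⇒alive k (states (suc s) x) ra) (aliveRed⇒red k (states (suc s) x) ra))
      where
      le' = ≤-trans (n≤1+n s) le
      σ0 = states s
      σ1 = states (suc s)
      h : aliveBlue k (σ0 y) ≡ true × target k G σ0 y ≡ nothing × σ1 y ≡ σ0 y →
          RedStepCase k σ0 x → stopped (σ1 x) ≡ false
      h _ (inj₂ (_ , _ , _ , _ , sz)) = sz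
      h (bb , et , ey) (inj₁ (ra0 , lx , sx)) = ⊥-elim (just≢nothing (trans (target-blue k σ0 y bb) (proj₂ fc)) et)
        where
        sf : stopped (σ0 x) ≡ false
        sf = red-next-to-blue-unstopped s le' x y ra0 bb ad
        ax = aliveRed⇒alive k (σ0 x) ra0
        ay = aliveBlue⇒alive k (σ0 y) bb
        qi : Eligible k σ0 y x
        qi = record { e-adj = trans (symG y x) ad ; e-alive = ax ; e-red = aliveRed⇒red k (σ0 x) ra0 ; e-unstopped = sf
                    ; e-prefix = trans (proj₂ (alive-origin s le' x ax))
                             (trans (pinv x y (proj₁ (alive-origin s le' x ax)) (proj₁ (alive-origin s le' y ay)) ad)
                                    (sym (proj₂ (alive-origin s le' y ay)))) }
        fc = firstBelow-complete M (eligible k G σ0 y) x (adjB x y ad) (eligible⁺ k σ0 y x qi)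

    size-pos : ∀ s → s ≤ T → ∀ x → alive (states s x) ≡ true → 1 ≤ clusterSize (states s) (label (states s x))
    size-pos s le x a = countBelow-pos M (λ z → alive (states s z) ∧ (label (states s z) ≡ᵇ label (states s x))) x (inSB x (alive⇒living (invariant-states s le) x a)) (∧-true⁺ a (≡ᵇ-refl (label (states s x))))

    unstopped-large : ∀ s → s ≤ T → ∀ x → aliveRed k (states s x) ≡ true → stopped (states s x) ≡ false →
         suc K ^ s ≤ clusterSize (states s) (label (states s x)) * K ^ s
    unstopped-large zero le x ra _ = subst (1 ≤_) (sym (*-identityʳ _)) (size-pos zero le x (aliveRed⇒alive k (states zero x) ra))
    unstopped-large (suc s) le x ra sf =
      h (S.red-step⁻¹ s le x (aliveRed⇒alive k (states (suc s) x) ra) (aliveRed⇒red k (states (suc s) x) ra))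
      where
      σ1 = states (suc s)
      le' = ≤-trans (n≤1+n s) le
      σ0 = states s
      grows : ∀ w → aliveRed k (σ0 w) ≡ true → stopped (σ0 w) ≡ false → accepted k σ0 (label (σ0 w)) ≡ true →
               suc K ^ suc s ≤ clusterSize σ1 (label (σ0 w)) * K ^ suc s
      grows w rw sw aw = growth-step (suc K ^ s) (K ^ s) (clusterSize σ0 c) (clusterSize σ1 c) (proposals k σ0 c)
          (≤ᵇ-sound _ _ aw)
          (S.accepted-grows s le c aw (aliveRed⇒red k (σ0 w) rw)
             (λ x' a' l' → trans (stopped-uniform s le' x' w a' (aliveRed⇒alive k (σ0 w) rw) l') sw))
          (unstopped-large s le' w rw sw)
        where c = label (σ0 w)
      h : RedStepCase k σ0 x → suc K ^ suc s ≤ clusterSize σ1 (label (σ1 x)) * K ^ suc s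
      h (inj₁ (ra0 , lx , sx)) = subst (λ w → suc K ^ suc s ≤ clusterSize σ1 w * K ^ suc s) (sym lx)
          (grows x ra0 (∨-false⁻ˡ (trans (sym sx) sf)) (not-false⁻ (∨-false⁻ʳ {stopped (σ0 x)} (trans (sym sx) sf))))
      h (inj₂ (z , et , ac , lz , _)) = subst (λ w → suc K ^ suc s ≤ clusterSize σ1 w * K ^ suc s) (sym lz)
          (grows z (red⇒aliveRed k (σ0 z) (e-alive qi) (e-red qi)) (e-unstopped qi) ac)
        where
        qi = eligible⁻ k σ0 x z (proj₂ (proj₂ (target⇒eligible k σ0 x z et)))

    potential-bound : ∀ s → s ≤ T → K * aliveCount σ ≤ K * aliveCount (states s) + stoppedCount k (states s)
    potential-bound zero _ = m≤m+n _ _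
    potential-bound (suc s) le = ≤-trans (potential-bound s le') (S.potential-step s le (stopped-uniform s le'))
      where le' = ≤-trans (n≤1+n s) le

    RecordsBound : NodeState → Set
    RecordsBound w = length (records w) ≤ L0 ⊎ (length (records w) ≤ suc L0 × aliveRed k w ≡ true)

    records-bound : ∀ s → s ≤ T → ∀ y → RecordsBound (states s y)
    records-bound zero _ y = inj₁ (records≤ y)
    records-bound (suc s) le y = h (S.stepCase s le k y)
      where
      le' = ≤-trans (n≤1+n s) le
      σ0 = states s
      IH = records-bound s le' y
      h : S.StepCase s le k y (stepAll k G σ0 y) → RecordsBound (stepAll k G σ0 y)
      h (S.stays _ _ e) = subst RecordsBound (sym e) IH
      h (S.joins z et _ e) = subst RecordsBound (sym e) (hj IH)
        where
        bq = target⇒eligible k σ0 y z et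
        hj : RecordsBound (σ0 y) → RecordsBound (joinCluster (σ0 y) z (σ0 z))
        hj (inj₁ l0) = inj₂ (≤-trans (length-addRecord (label (σ0 z)) z (suc (depthIn (label (σ0 z)) (records (σ0 z)))) (records (σ0 y))) (s≤s l0) ,
                            ∧-true⁺ (aliveBlue⇒alive k (σ0 y) (proj₁ bq)) (e-red (eligible⁻ k σ0 y z (proj₂ (proj₂ bq)))))
        hj (inj₂ (_ , ra)) = ⊥-elim (red-blue-disjoint k (σ0 y) ra (proj₁ bq))
      h (S.dies z et _ e) = subst RecordsBound (sym e) (hd IH)
        where
        hd : RecordsBound (σ0 y) → RecordsBound (kill (σ0 y))
        hd (inj₁ l0) = inj₁ l0
        hd (inj₂ (_ , ra)) = ⊥-elim (red-blue-disjoint k (σ0 y) ra (proj₁ (target⇒eligible k σ0 y z et)))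
      h (S.redUpdate _ _ _ e) = subst RecordsBound (sym e) IH
      h (S.untouched _ _ e) = subst RecordsBound (sym e) IH

    records-end : ∀ y → length (records (states T y)) ≤ suc L0
    records-end y = h (records-bound T ≤-refl y)
      where
      h : RecordsBound (states T y) → length (records (states T y)) ≤ suc L0
      h (inj₁ l) = ≤-trans l (n≤1+n L0)
      h (inj₂ (l , _)) = l

    invariant-end : Invariant (t0 + T) (states T)
    invariant-end = invariant-states T ≤-refl

    deaths-end : K * aliveCount σ ≤ K * aliveCount (states T) + aliveCount (states T)
    deaths-end = ≤-trans (potential-bound T ≤-refl) (+-monoʳ-≤ (K * aliveCount (states T))
      (countBelow-mono M (λ y → aliveRed k (states T y) ∧ stopped (states T y)) (λ y → alive (states T y))
         (λ y _ h → aliveRed⇒alive k (states T y) (∧-true⁻ˡ {aliveRed k (states T y)} h))))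

    -- A red cluster still growing after T steps would have more than M members.
    no-red-blue-edge : ∀ x y → aliveRed k (states T x) ≡ true → aliveBlue k (states T y) ≡ true →
      adjG G x y ≡ true → ⊥
    no-red-blue-edge x y ra bb ad = h (stopped (states T x)) refl
      where
      h : ∀ b → stopped (states T x) ≡ b → ⊥
      h true es = true≢false es (red-next-to-blue-unstopped T ≤-refl x y ra bb ad)
      h false es = <⇒≱ grow (≤-trans (unstopped-large T ≤-refl x ra es)
                     (*-monoˡ-≤ (K ^ T) (countBelow≤ M (λ z → alive (states T z) ∧ (label (states T z) ≡ᵇ label (states T x))))))

    prefix-end : PrefixAgree k (states T)
    prefix-end x y ax ay ad = ⌊n/2⌋-odd-injective (dropBits k (label (states T x))) (dropBits k (label (states T y))) higherBits
                            (bitK (odd (dropBits k (label (states T x)))) (odd (dropBits k (label (states T y)))) refl refl)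
      where
      originX = alive-origin T ≤-refl x ax
      originY = alive-origin T ≤-refl y ay
      higherBits : ⌊ dropBits k (label (states T x)) /2⌋ ≡ ⌊ dropBits k (label (states T y)) /2⌋
      higherBits = trans (proj₂ originX) (trans (pinv x y (proj₁ originX) (proj₁ originY) ad) (sym (proj₂ originY)))
      bitK : ∀ b1 b2 → odd (dropBits k (label (states T x))) ≡ b1 → odd (dropBits k (label (states T y))) ≡ b2 →
           odd (dropBits k (label (states T x))) ≡ odd (dropBits k (label (states T y)))
      bitK true true ex ey = trans ex (sym ey)
      bitK false false ex ey = trans ex (sym ey)
      bitK true false ex ey = ⊥-elim (no-red-blue-edge x y (red⇒aliveRed k (states T x) ax ex) (notRed⇒aliveBlue k (states T y) ay ey) ad)
      bitK false true ex ey = ⊥-elim (no-red-blue-edge y x (red⇒aliveRed k (states T y) ay ey) (notRed⇒aliveBlue k (states T x) ax ex) (trans (symG y x) ad))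

module RunLemmas (M ρ K T Dmax : ℕ) (G : IdGraph)
  (symG : ∀ a b → adjG G a b ≡ adjG G b a)
  (adjB : ∀ a b → adjG G a b ≡ true → a < M)
  (inSB : ∀ y → inSG G y ≡ true → y < M)
  (ρ-big : suc Dmax + suc Dmax ≤ ρ)
  (grow : M * K ^ T < suc K ^ T)
  where
  open Clustering M ρ K T
  open PhaseLemmas M ρ K T Dmax G symG adjB inSB ρ-big grow public

  alive-phase : ∀ k {t0} {σ} (gi0 : Invariant t0 σ) (tT : t0 + T ≤ Dmax) (pinv : PrefixAgree (suc k) σ) L0 records≤ →
    aliveCount (phase k G σ) ≤ aliveCount σ
  alive-phase k gi0 tT pinv L0 records≤ =
    countBelow-mono M _ _ (λ y _ a → proj₁ (PhaseRun.alive-origin k gi0 tT pinv L0 records≤ T ≤-refl y a))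

  record PhasesResult (k t L0 : ℕ) (σ σf : ℕ → NodeState) : Set where
    field
      invariant : Invariant (t + k * T) σf
      prefixes-agree : PrefixAgree 0 σf
      records-bounded : ∀ y → length (records (σf y)) ≤ L0 + k
      deaths-bounded : K * aliveCount σ ≤ K * aliveCount σf + k * aliveCount σ

  phases-result : ∀ k t L0 σ → Invariant t σ → t + k * T ≤ Dmax → PrefixAgree k σ →
           (∀ y → length (records (σ y)) ≤ L0) → PhasesResult k t L0 σ (phases k G σ)
  phases-result zero t L0 σ gi tb pinv len = record
    { invariant = subst (λ w → Invariant w σ) (sym (+-identityʳ t)) gi
    ; prefixes-agree = pinv
    ; records-bounded = λ y → subst (length (records (σ y)) ≤_) (sym (+-identityʳ L0)) (len y)
    ; deaths-bounded = subst (K * aliveCount σ ≤_) (sym (+-identityʳ _)) ≤-refl }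
  phases-result (suc k) t L0 σ gi tb pinv len = record
    { invariant = subst (λ w → Invariant w σf) (+-assoc t T (k * T)) (PhasesResult.invariant IH)
    ; prefixes-agree = PhasesResult.prefixes-agree IH
    ; records-bounded = λ y → subst (length (records (σf y)) ≤_) (sym (+-suc L0 k)) (PhasesResult.records-bounded IH y)
    ; deaths-bounded = deaths }
    where
    tT : t + T ≤ Dmax
    tT = ≤-trans (+-monoʳ-≤ t (m≤m+n T (k * T))) tb
    module Ph = PhaseRun k gi tT pinv L0 len
    σ1 = phase k G σ
    σf = phases k G σ1
    IH : PhasesResult k (t + T) (suc L0) σ1 σf
    IH = phases-result k (t + T) (suc L0) σ1 Ph.invariant-end
           (subst (_≤ Dmax) (sym (+-assoc t T (k * T))) tb) Ph.prefix-end Ph.records-end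
    alive-decreases : aliveCount σ1 ≤ aliveCount σ
    alive-decreases = alive-phase k gi tT pinv L0 len
    deaths : K * aliveCount σ ≤ K * aliveCount σf + suc k * aliveCount σ
    deaths = begin
      K * aliveCount σ ≤⟨ Ph.deaths-end ⟩
      K * aliveCount σ1 + aliveCount σ1 ≤⟨ +-monoˡ-≤ (aliveCount σ1) (PhasesResult.deaths-bounded IH) ⟩
      K * aliveCount σf + k * aliveCount σ1 + aliveCount σ1 ≤⟨ +-mono-≤ (+-monoʳ-≤ (K * aliveCount σf) (*-monoʳ-≤ k alive-decreases)) alive-decreases ⟩
      K * aliveCount σf + k * aliveCount σ + aliveCount σ ≡⟨ +-assoc (K * aliveCount σf) (k * aliveCount σ) (aliveCount σ) ⟩
      K * aliveCount σf + (k * aliveCount σ + aliveCount σ) ≡⟨ cong (K * aliveCount σf +_) (+-comm (k * aliveCount σ) (aliveCount σ)) ⟩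
      K * aliveCount σf + suc k * aliveCount σ ∎
      where open ≤-Reasoning

  module Final (B : ℕ) (M≡ : M ≡ 2 ^ B) (DB : B * T ≤ Dmax) where
    σ0 = initial G
    σf = final B G

    prefix-initial : PrefixAgree B σ0
    prefix-initial x y ax ay _ = trans (dropBits-<2^ B x (subst (x <_) M≡ (inSB x ax)))
                         (sym (dropBits-<2^ B y (subst (y <_) M≡ (inSB y ay))))

    records-initial : ∀ y → length (records (σ0 y)) ≤ 1
    records-initial y with inSG G y
    ... | true = ≤-refl
    ... | false = z≤n

    result : PhasesResult B 0 1 σ0 σf
    result = phases-result B 0 1 σ0 invariant-initial DB prefix-initial records-initial

-- Choice of the parameters

bernoulli-gen : ∀ a j → a ^ j * (a + j) ≤ a * suc a ^ j
bernoulli-gen a zero = ≤-reflexive (e a)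
  where
  e : ∀ a → 1 * (a + 0) ≡ a * 1
  e = solve-∀
bernoulli-gen a (suc j) = begin
  a * a ^ j * (a + (1 + j)) ≤⟨ m≤m+n _ (a ^ j * j) ⟩
  a * a ^ j * (a + (1 + j)) + a ^ j * j ≡⟨ e a (a ^ j) j ⟩
  (1 + a) * (a ^ j * (a + j)) ≤⟨ *-monoʳ-≤ (1 + a) (bernoulli-gen a j) ⟩
  (1 + a) * (a * suc a ^ j) ≡⟨ e2 a (suc a ^ j) ⟩
  a * ((1 + a) * suc a ^ j) ∎
  where
  open ≤-Reasoning
  e : ∀ a X j → a * X * (a + (1 + j)) + X * j ≡ (1 + a) * (X * (a + j))
  e = solve-∀
  e2 : ∀ a Y → (1 + a) * (a * Y) ≡ a * ((1 + a) * Y)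
  e2 = solve-∀

bernoulli : ∀ a → 1 ≤ a → 2 * a ^ a ≤ suc a ^ a
bernoulli (suc a) _ = *-cancelˡ-≤ (suc a) (≤-trans (≤-reflexive (e (suc a) (suc a ^ suc a))) (bernoulli-gen (suc a) (suc a)))
  where
  e : ∀ a X → a * (2 * X) ≡ X * (a + a)
  e = solve-∀

^-distribʳ-* : ∀ a b output → (a * b) ^ output ≡ a ^ output * b ^ output
^-distribʳ-* a b zero = refl
^-distribʳ-* a b (suc output) rewrite ^-distribʳ-* a b output = e a b (a ^ output) (b ^ output)
  where
  e : ∀ a b x y → a * b * (x * y) ≡ a * x * (b * y)
  e = solve-∀

growth : ∀ K Q B → 1 ≤ K → B < Q → 2 ^ B * K ^ (K * Q) < suc K ^ (K * Q)
growth K Q B 1≤K B<Q = begin-strict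
  2 ^ B * K ^ (K * Q) <⟨ *-monoˡ-< (K ^ (K * Q)) {{m^n≢0 K (K * Q) {{>-nonZero 1≤K}}}} (^-monoʳ-< 2 (s≤s (s≤s z≤n)) B<Q) ⟩
  2 ^ Q * K ^ (K * Q) ≡⟨ cong (2 ^ Q *_) (sym (^-*-assoc K K Q)) ⟩
  2 ^ Q * (K ^ K) ^ Q ≡⟨ sym (^-distribʳ-* 2 (K ^ K) Q) ⟩
  (2 * K ^ K) ^ Q ≤⟨ ^-monoˡ-≤ Q (bernoulli K 1≤K) ⟩
  (suc K ^ K) ^ Q ≡⟨ ^-*-assoc (suc K) K Q ⟩
  suc K ^ (K * Q) ∎
  where open ≤-Reasoning

constant : ℕ → ℕ
constant cid = 14 * suc cid ^ 6

-- Q = (cid + 1) · Lv exceeds the number B of identifier bits. With K = 2Q the deaths of all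
-- B phases add up to at most half of S; T = K · Q steps let an accepting cluster outgrow
-- 2^B nodes; Dmax = B · T bounds the tree depths, and a ρ-ball around a node that sees a
-- cluster contains the whole cluster together with its proposers.
module Parameters (cid Lv : ℕ) (1≤L : 1 ≤ Lv) where
  c1 = suc cid
  Q = c1 * Lv
  B = cid * Lv
  K = 2 * Q
  T = K * Q
  Dmax = B * T
  ρ = suc Dmax + suc Dmax
  R = B * (T * suc ρ) + 0

  1≤c1 : 1 ≤ c1
  1≤c1 = s≤s z≤n

  1≤Q : 1 ≤ Q
  1≤Q = *-mono-≤ 1≤c1 1≤L

  B<Q : B < Q
  B<Q = m<n+m B 1≤L

  B≤Q : B ≤ Q
  B≤Q = <⇒≤ B<Q

  1≤K : 1 ≤ K
  1≤K = ≤-trans 1≤Q (m≤m+n Q (Q + 0))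

  q3 = Q * Q * Q
  1≤q3 : 1 ≤ q3
  1≤q3 = *-mono-≤ (*-mono-≤ 1≤Q 1≤Q) 1≤Q

  Dmax≤ : Dmax ≤ 2 * q3
  Dmax≤ = ≤-trans (*-monoˡ-≤ T B≤Q) (≤-reflexive (e Q))
    where
    e : ∀ q → q * (2 * q * q) ≡ 2 * (q * q * q)
    e = solve-∀

  sρ≤ : suc ρ ≤ 7 * q3
  sρ≤ = begin
    suc (suc Dmax + suc Dmax) ≡⟨ e Dmax ⟩
    3 + (Dmax + Dmax) ≤⟨ +-monoʳ-≤ 3 (+-mono-≤ Dmax≤ Dmax≤) ⟩
    3 + (2 * q3 + 2 * q3) ≤⟨ +-monoˡ-≤ (2 * q3 + 2 * q3) (*-monoʳ-≤ 3 1≤q3) ⟩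
    3 * q3 + (2 * q3 + 2 * q3) ≡⟨ e2 q3 ⟩
    7 * q3 ∎
    where
    open ≤-Reasoning
    e : ∀ d → suc (suc d + suc d) ≡ 3 + (d + d)
    e = solve-∀
    e2 : ∀ q → 3 * q + (2 * q + 2 * q) ≡ 7 * q
    e2 = solve-∀

  c1≤ : ∀ k → c1 ≤ c1 * c1 ^ k
  c1≤ k = m≤m*n c1 (c1 ^ k) {{m^n≢0 c1 k}}

  c6 : ℕ
  c6 = c1 * (c1 * (c1 * (c1 * (c1 * (c1 * 1)))))

  rounds≤ : R ≤ constant cid * Lv ^ 6
  rounds≤ = begin
    B * (T * suc ρ) + 0 ≡⟨ +-identityʳ _ ⟩
    B * (T * suc ρ) ≤⟨ *-mono-≤ B≤Q (*-monoʳ-≤ T sρ≤) ⟩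
    Q * (T * (7 * q3)) ≡⟨ e c1 Lv ⟩
    14 * c6 * (Lv * (Lv * (Lv * (Lv * (Lv * (Lv * 1)))))) ∎
    where
    open ≤-Reasoning
    e : ∀ c l → (c * l) * (2 * (c * l) * (c * l) * (7 * ((c * l) * (c * l) * (c * l)))) ≡
                14 * (c * (c * (c * (c * (c * (c * 1)))))) * (l * (l * (l * (l * (l * (l * 1))))))
    e = solve-∀

  diameter≤ : Dmax + Dmax ≤ constant cid * Lv ^ 3
  diameter≤ = begin
    Dmax + Dmax ≤⟨ +-mono-≤ Dmax≤ Dmax≤ ⟩
    2 * q3 + 2 * q3 ≡⟨ e c1 Lv ⟩
    4 * (c1 * (c1 * (c1 * 1))) * (Lv * (Lv * (Lv * 1))) ≤⟨ *-monoˡ-≤ (Lv * (Lv * (Lv * 1))) (*-mono-≤ (m≤n+m 4 10) (c3≤c6)) ⟩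
    14 * c6 * (Lv * (Lv * (Lv * 1))) ∎
    where
    open ≤-Reasoning
    e : ∀ c l → 2 * ((c * l) * (c * l) * (c * l)) + 2 * ((c * l) * (c * l) * (c * l)) ≡
                4 * (c * (c * (c * 1))) * (l * (l * (l * 1)))
    e = solve-∀
    c3≤c6 : c1 * (c1 * (c1 * 1)) ≤ c6
    c3≤c6 = ≤-trans (m≤m*n (c1 * (c1 * (c1 * 1))) (c1 * (c1 * (c1 * 1))) {{m^n≢0 c1 3}})
              (≤-reflexive (e3 c1))
      where
      e3 : ∀ c → c * (c * (c * 1)) * (c * (c * (c * 1))) ≡ c * (c * (c * (c * (c * (c * 1)))))
      e3 = solve-∀

  at-least-half-survive : ∀ A0 Af → K * A0 ≤ K * Af + B * A0 → A0 ≤ 2 * Af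
  at-least-half-survive A0 Af deaths = *-cancelˡ-≤ Q {{>-nonZero 1≤Q}} (+-cancelʳ-≤ (Q * A0) (Q * A0) (Q * (2 * Af)) h)
    where
    e1 : ∀ q a → 2 * q * a ≡ q * a + q * a
    e1 = solve-∀
    e2 : ∀ q a → 2 * q * a ≡ q * (2 * a)
    e2 = solve-∀
    h : Q * A0 + Q * A0 ≤ Q * (2 * Af) + Q * A0
    h = begin
      Q * A0 + Q * A0 ≡⟨ sym (e1 Q A0) ⟩
      K * A0 ≤⟨ deaths ⟩
      K * Af + B * A0 ≤⟨ +-mono-≤ (≤-reflexive (e2 Q Af)) (*-monoˡ-≤ A0 B≤Q) ⟩
      Q * (2 * Af) + Q * A0 ∎
      where open ≤-Reasoning

  congestion≤ : suc B + suc B ≤ constant cid * Lv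
  congestion≤ = begin
    suc B + suc B ≤⟨ +-mono-≤ B<Q B<Q ⟩
    Q + Q ≤⟨ ≤-reflexive (e c1 Lv) ⟩
    2 * c1 * Lv ≤⟨ *-monoˡ-≤ Lv (*-mono-≤ (m≤n+m 2 12) (c1≤ 5)) ⟩
    14 * c6 * Lv ∎
    where
    open ≤-Reasoning
    e : ∀ c l → c * l + c * l ≡ 2 * c * l
    e = solve-∀

module Construction (cid n : ℕ) where
  open Parameters cid (L n) (s≤s z≤n)

  M : ℕ
  M = 2 ^ B

  open Clustering M ρ K T

  toOutput : NodeState → Output
  toOutput s = out (alive s) (label s)

  runOn : Instance n → Fin n → Output
  runOn I v = toOutput (final B (IdGraphOf.G I) (ident I v))

  clusteringAlgorithm : Algorithm n
  clusteringAlgorithm = record { rounds = R ; run = runOn ; local = runOn-local }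
    where
    runOn-local : ∀ (I J : Instance n) v w → SameView R I v J w → runOn I v ≡ runOn J w
    runOn-local I J v w sv = cong toOutput (trans (final-local B (IdGraphOf.G I) (IdGraphOf.G J) (ident I v)
                       (ViewAgree.view-agree I J M R v w sv)) (cong (final B (IdGraphOf.G J)) (proj₁ sv)))

  module Correctness (I : Instance n) (bnd : IdsBounded cid I) where
    open IdGraphOf I using (G; adjG-sym; adj-inv; inS-inv; inS-id; adj-id; nodeOf; nodeOf-ident; nodeOf-sound)

    adjB : ∀ a b → adjG G a b ≡ true → a < M
    adjB a b e with adj-inv a b e
    ... | u , _ , eu , _ , _ = subst (_< M) eu (bnd u)

    inSB : ∀ y → inSG G y ≡ true → y < M
    inSB y e with inS-inv y e
    ... | u , eu , _ = subst (_< M) eu (bnd u)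

    more-than-M : M * K ^ T < suc K ^ T
    more-than-M = growth K Q B 1≤K B<Q

    open RunLemmas M ρ K T Dmax G adjG-sym adjB inSB ≤-refl more-than-M
    open Final B refl ≤-refl

    invariant-final : Invariant Dmax σf
    invariant-final = PhasesResult.invariant result

    module AtEnd = UnderInvariant invariant-final ≤-refl

    output : Fin n → Output
    output = runOn I

    count-S≡aliveCount : count (inS I) ≡ aliveCount σ0
    count-S≡aliveCount = trans (count≡sumFin (inS I)) (trans (sumFin-cong n (λ u → cong fromBool (sym (inS-id u))))
      (sumFin≡countBelow (ident I) (ident-inj I) M bnd (inSG G) (λ y e → let (u , eu , _) = inS-inv y e in u , eu)))

    count-S′≡aliveCount : count (λ u → inS′ (output u)) ≡ aliveCount σf
    count-S′≡aliveCount = trans (count≡sumFin (λ u → inS′ (output u)))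
      (sumFin≡countBelow (ident I) (ident-inj I) M bnd (λ y → alive (σf y))
        (λ y e → let (u , eu , _) = inS-inv y (alive⇒living invariant-final y e) in u , eu))

    large′ : count (inS I) ≤ 2 * count (λ u → inS′ (output u))
    large′ = subst₂ (λ a b → a ≤ 2 * b) (sym count-S≡aliveCount) (sym count-S′≡aliveCount) (at-least-half-survive (aliveCount σ0) (aliveCount σf) (PhasesResult.deaths-bounded result))

    sameCentre⇒WithinDist : ∀ u v c d1 d2 → d1 ≤ Dmax → d2 ≤ Dmax → Ball G d1 c (ident I u) ≡ true →
      Ball G d2 c (ident I v) ≡ true → WithinDist I (constant cid * L n ^ 3) u v
    sameCentre⇒WithinDist u v c d1 d2 d1≤ d2≤ b1 b2 = toWalk (IdGraphOf.Ball⇒Walk I M (d1 + d2) u (ident I v)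
        (ball-tri G d2 d1 (ident I u) c (ident I v) (ball-sym G adjG-sym adjB d1 c (ident I u) b1) b2))
      where
      toWalk : Σ[ u' ∈ Fin n ] (ident I u' ≡ ident I v × WithinDist I (d1 + d2) u u') →
        WithinDist I (constant cid * L n ^ 3) u v
      toWalk (u' , eu' , k , k≤ , w) = k , ≤-trans k≤ (≤-trans (+-mono-≤ d1≤ d2≤) diameter≤) ,
        subst (λ z → Walk I u z k) (ident-inj I u' v eu') w

    weakDiam′ : ∀ u v → InS′ I output u → InS′ I output v → cluster (output u) ≡ cluster (output v) →
      WithinDist I (constant cid * L n ^ 3) u v
    weakDiam′ u v a b l =
      let (d1 , d1≤ , b1) = AtEnd.member-ball (ident I u) (label (σf (ident I u))) a refl
          (d2 , d2≤ , b2) = AtEnd.member-ball (ident I v) (label (σf (ident I u))) b (sym l)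
      in sameCentre⇒WithinDist u v (label (σf (ident I u))) d1 d2 d1≤ d2≤ b1 b2

    module SteinerTrees (σg : ℕ → NodeState) (gg : Invariant Dmax σg) where
      record⇒centreRecord : ∀ d y c p → findRecord c (records (σg y)) ≡ just (p , d) →
        hasRecord c (records (σg c)) ≡ true
      record⇒centreRecord d y c p e with record-justified gg y c p d e
      ... | _ , inj₁ (refl , _) = found⇒hasRecord c (records (σg y)) e
      record⇒centreRecord (suc d') y c p e | _ , inj₂ (.d' , refl , _ , p' , e') = record⇒centreRecord d' p c p' e'

      centreOf : ∀ c u0 → alive (σg (ident I u0)) ≡ true → label (σg (ident I u0)) ≡ c →
        Σ[ r ∈ Fin n ] (ident I r ≡ c × hasRecord c (records (σg c)) ≡ true)
      centreOf c u0 a0 l0 with hasRecord⇒found c (records (σg (ident I u0)))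
                                     (subst (λ w → hasRecord w (records (σg (ident I u0))) ≡ true) l0 (alive⇒ownRecord gg (ident I u0) a0))
      ... | p , d , e with record⇒centreRecord d (ident I u0) c p e
      ... | hc with inS-inv c (record⇒living gg c c hc)
      ... | r , er , _ = r , er , hc

      module ClusterTree (c : ℕ) (r : Fin n) (er : ident I r ≡ c) (hc : hasRecord c (records (σg c)) ≡ true) where

        inT′ : Fin n → Bool
        inT′ u = hasRecord c (records (σg (ident I u)))

        parent′ : Fin n → Fin n
        parent′ u = fromMaybe r (nodeOf (parentIn c (records (σg (ident I u)))))

        depth′ : Fin n → ℕ
        depth′ u = depthIn c (records (σg (ident I u)))

        rootIn : inT′ r ≡ true
        rootIn = subst (λ z → hasRecord c (records (σg z)) ≡ true) (sym er) hc

        rootDep : depth′ r ≡ 0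
        rootDep rewrite er with hasRecord⇒found c (records (σg c)) hc
        ... | p , d , e = trans (found⇒depthIn c (records (σg c)) e) (centre-depth0 gg c p d e)

        record NonRoot (u : Fin n) : Set where
          field
            pa : Fin n
            paEq : parent′ u ≡ pa
            paIn : inT′ pa ≡ true
            paAdj : adj I u pa ≡ true
            paDep : suc (depth′ pa) ≡ depth′ u

        nonroot : ∀ u → inT′ u ≡ true → ¬ (u ≡ r) → NonRoot u
        nonroot u iu nr with hasRecord⇒found c (records (σg (ident I u))) iu
        ... | p , d , e with record-justified gg (ident I u) c p d e
        ... | _ , inj₁ (eu , _) = ⊥-elim (nr (ident-inj I u r (trans eu (sym er))))
        ... | _ , inj₂ (d' , refl , adp , p' , e') with adj-inv p (ident I u) adp
        ... | a , b , ea , eb , ad rewrite ident-inj I b u eb = record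
          { pa = a
          ; paEq = trans (cong (λ w → fromMaybe r (nodeOf (recordParent w))) e)
                     (cong (fromMaybe r) (trans (cong nodeOf (sym ea)) (nodeOf-ident a)))
          ; paIn = subst (λ z → hasRecord c (records (σg z)) ≡ true) (sym ea) (found⇒hasRecord c (records (σg p)) e')
          ; paAdj = trans (adj-sym I u a) ad
          ; paDep = trans (cong suc (subst (λ z → depthIn c (records (σg z)) ≡ d') (sym ea) (found⇒depthIn c (records (σg p)) e')))
                          (sym (found⇒depthIn c (records (σg (ident I u))) e)) }

        tree : SteinerTree I (constant cid * L n ^ 3)
        tree = record
          { inT = inT′
          ; root = r
          ; parent = parent′
          ; depth = depth′
          ; root-in = rootIn
          ; root-dep = rootDep
          ; par-in = λ u iu nr → let q = nonroot u iu nr in subst (λ w → inT′ w ≡ true) (sym (NonRoot.paEq q)) (NonRoot.paIn q)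
          ; par-adj = λ u iu nr → let q = nonroot u iu nr in subst (λ w → adj I u w ≡ true) (sym (NonRoot.paEq q)) (NonRoot.paAdj q)
          ; par-dep = λ u iu nr → let q = nonroot u iu nr in subst (λ w → suc (depth′ w) ≡ depth′ u) (sym (NonRoot.paEq q)) (NonRoot.paDep q)
          ; dep-bound = depth≤ }
          where
          depth≤ : ∀ u → inT′ u ≡ true → depth′ u ≤ constant cid * L n ^ 3
          depth≤ u iu with hasRecord⇒found c (records (σg (ident I u))) iu
          ... | p , d , e = ≤-trans (≤-reflexive (found⇒depthIn c (records (σg (ident I u))) e))
                              (≤-trans (proj₁ (record-justified gg (ident I u) c p d e)) (≤-trans (m≤m+n Dmax Dmax) diameter≤))

    trees′ : (c : ℕ) → UsedLabel I output c → SteinerTree I (constant cid * L n ^ 3)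
    trees′ c h = let (r , er , hc) = SteinerTrees.centreOf σf invariant-final c (proj₁ h) (proj₁ (proj₂ h)) (proj₂ (proj₂ h))
                 in SteinerTrees.ClusterTree.tree σf invariant-final c r er hc

    recordedLabels : Fin n → List ℕ
    recordedLabels z = map proj₁ (records (σf (ident I z)))

    EdgeIn⇒recorded : ∀ x y c h → EdgeIn (trees′ c h) x y → c ∈ recordedLabels x ++ recordedLabels y
    EdgeIn⇒recorded x y c h (inj₁ (ix , _)) = ∈-++⁺ˡ (hasRecord⇒∈ c (records (σf (ident I x))) ix)
    EdgeIn⇒recorded x y c h (inj₂ (iy , _)) = ∈-++⁺ʳ (recordedLabels x) (hasRecord⇒∈ c (records (σf (ident I y))) iy)

    tree-edges⇒recorded : ∀ x y {P : Σ ℕ (UsedLabel I output) → Set} → (∀ c h → P (c , h) → EdgeIn (trees′ c h) x y) →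
      ∀ cs → All P cs → All (λ c → c ∈ recordedLabels x ++ recordedLabels y) (map proj₁ cs)
    tree-edges⇒recorded x y f cs al = All.map⁺ (All.map (λ { {c , h} p → EdgeIn⇒recorded x y c h (f c h p) }) al)

    edge-congestion : ∀ x y {P : Σ ℕ (UsedLabel I output) → Set} → (∀ c h → P (c , h) → EdgeIn (trees′ c h) x y) →
      (cs : List (Σ ℕ (UsedLabel I output))) → Unique (map proj₁ cs) → All P cs → length cs ≤ constant cid * L n
    edge-congestion x y f cs uq al = begin
      length cs ≡⟨ sym (length-map proj₁ cs) ⟩
      length (map proj₁ cs) ≤⟨ Unique-length≤ (map proj₁ cs) (recordedLabels x ++ recordedLabels y) uq (tree-edges⇒recorded x y f cs al) ⟩
      length (recordedLabels x ++ recordedLabels y) ≡⟨ length-++ (recordedLabels x) ⟩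
      length (recordedLabels x) + length (recordedLabels y) ≡⟨ cong₂ _+_ (length-map proj₁ (records (σf (ident I x)))) (length-map proj₁ (records (σf (ident I y)))) ⟩
      length (records (σf (ident I x))) + length (records (σf (ident I y))) ≤⟨ +-mono-≤ (PhasesResult.records-bounded result (ident I x)) (PhasesResult.records-bounded result (ident I y)) ⟩
      suc B + suc B ≤⟨ congestion≤ ⟩
      constant cid * L n ∎
      where open ≤-Reasoning

    valid : Valid I output (constant cid)
    valid = record
      { subset = λ u a → trans (sym (inS-id u)) (alive⇒living invariant-final (ident I u) a)
      ; large = large′
      ; nonadj = λ u v a b ad → PhasesResult.prefixes-agree result (ident I u) (ident I v) a b (trans (adj-id u v) ad)
      ; weakDiam = weakDiam′
      ; trees = trees′
      ; terminals = λ c h u ic → subst (λ w → hasRecord w (records (σf (ident I u))) ≡ true) (proj₂ ic) (alive⇒ownRecord invariant-final (ident I u) (proj₁ ic))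
      ; congestion = λ x y ad cs uq al → edge-congestion x y (λ c h p → p) cs uq al }

lemma2p4 : (cid : ℕ) →
    Σ ℕ λ C → Σ ((n : ℕ) → Algorithm n) λ A →
    (n : ℕ) → rounds (A n) ≤ C * L n ^ 6 ×
    ((I : Instance n) → IdsBounded cid I → Valid I (run (A n) I) C)
lemma2p4 cid = constant cid , (λ n → Construction.clusteringAlgorithm cid n) ,
  λ n → Parameters.rounds≤ cid (L n) (s≤s z≤n) , λ I bnd → Construction.Correctness.valid cid n I bnd
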